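{- Let $G$ be a nut graph, let $e = uv \in E(G)$ be a bridge of $G$, and let $\mathcal{E}$ be the orbit of $e$ under $\mathrm{Aut}(G)$. Let $B(G,\mathcal{E})$ be the graph obtained from $G$ by applying the bridge construction to every edge of $\mathcal{E}$. Then $B(G,\mathcal{E})$ is a nut graph and $\mathrm{Aut}(G) \leq \mathrm{Aut}(B(G,\mathcal{E}))$ (every automorphism of $G$ extends naturally to one of $B(G,\mathcal{E})$). If, in addition, $\mathrm{Aut}(G) \cong \mathrm{Aut}(B(G,\mathcal{E}))$, then: (i) if there exists $\varphi \in \mathrm{Aut}(G)$ with $u^\varphi = v$ and $v^\varphi = u$, then $o_v(B(G,\mathcal{E})) = o_v(G)+1$ and $o_e(B(G,\mathcal{E})) = o_e(G)+1$; (ii) if there is no such $\varphi$, then $o_v(B(G,\mathcal{E})) = o_v(G)+2$ and $o_e(B(G,\mathcal{E})) = o_e(G)+2$.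
   Context: A nut graph is a simple connected graph whose adjacency matrix has one-dimensional kernel spanned by a vector with no zero entry. A bridge is an edge whose removal disconnects the graph. The bridge construction on an edge $xy$ replaces it by a path $x w_1 w_2 y$ with two new vertices $w_1,w_2$. $\mathrm{Aut}(G)$ is the full automorphism group; $o_v$, $o_e$ are the numbers of its orbits on vertices and edges. -}

module Defs where

open import Data.Nat using (ℕ; zero; suc; _≤_)
open import Data.Fin using (Fin; zero; suc; _<_)
open import Data.Fin.Permutation using (Permutation′; _⟨$⟩ʳ_)
open import Data.Bool using (Bool; true; false; if_then_else_)
open import Data.Rational using (ℚ; 0ℚ; _+_; _*_)
open import Data.Product using (Σ; _×_; _,_; ∃; ∃-syntax)
open import Data.Sum using (_⊎_)
open import Relation.Nullary using (¬_)
open import Relation.Binary.PropositionalEquality using (_≡_; _≢_)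
open import Function using (_∘_; _⇔_)

record Graph : Set where
  field
    n      : ℕ
    adj    : Fin n → Fin n → Bool
    sym    : ∀ x y → adj x y ≡ adj y x
    irrefl : ∀ x → adj x x ≡ false

open Graph public

Adj : (G : Graph) → Fin (n G) → Fin (n G) → Set
Adj G x y = adj G x y ≡ true

data Reach {m : ℕ} (R : Fin m → Fin m → Set) : Fin m → Fin m → Set where
  here : ∀ {x} → Reach R x x
  step : ∀ {x y z} → R x y → Reach R y z → Reach R x z

ConnectedRel : (m : ℕ) → (Fin m → Fin m → Set) → Set
ConnectedRel m R = ∀ x y → Reach R x y

Connected : Graph → Set
Connected G = ConnectedRel (n G) (Adj G)

SamePair : ∀ {m} → Fin m → Fin m → Fin m → Fin m → Set
SamePair a b c d = (a ≡ c × b ≡ d) ⊎ (a ≡ d × b ≡ c)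

AdjMinus : (G : Graph) → Fin (n G) → Fin (n G) → Fin (n G) → Fin (n G) → Set
AdjMinus G u v a b = Adj G a b × ¬ SamePair a b u v

IsBridge : (G : Graph) → Fin (n G) → Fin (n G) → Set
IsBridge G u v = Adj G u v × ¬ ConnectedRel (n G) (AdjMinus G u v)

ΣQ : (m : ℕ) → (Fin m → ℚ) → ℚ
ΣQ zero    f = 0ℚ
ΣQ (suc m) f = f zero + ΣQ m (f ∘ suc)

AdjMul : (G : Graph) → (Fin (n G) → ℚ) → Fin (n G) → ℚ
AdjMul G x i = ΣQ (n G) (λ j → if adj G i j then x j else 0ℚ)

InKernel : (G : Graph) → (Fin (n G) → ℚ) → Set
InKernel G x = ∀ i → AdjMul G x i ≡ 0ℚ

-- Nut graph: connected, and ker A = span{x} for some x with no zero entry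
-- (n ≥ 1 ensures x ≠ 0, so the kernel is exactly one-dimensional).
Nut : Graph → Set
Nut G = Connected G × 1 ≤ n G ×
  Σ (Fin (n G) → ℚ) λ x →
    InKernel G x × (∀ i → x i ≢ 0ℚ) ×
    (∀ y → InKernel G y → Σ ℚ λ c → ∀ i → y i ≡ c * x i)

Aut : Graph → Set
Aut G = Σ (Permutation′ (n G)) λ σ →
  ∀ x y → adj G (σ ⟨$⟩ʳ x) (σ ⟨$⟩ʳ y) ≡ adj G x y

app : (G : Graph) → Aut G → Fin (n G) → Fin (n G)
app G (σ , _) x = σ ⟨$⟩ʳ x

-- Aut(G) ≅ Aut(H) as abstract groups (automorphisms compared pointwise)
AutIso : Graph → Graph → Set
AutIso G H = Σ (Aut G → Aut H) λ F →
  (∀ φ χ → (∀ x → app G φ x ≡ app G χ x) → ∀ y → app H (F φ) y ≡ app H (F χ) y) ×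
  (∀ φ χ ψ → (∀ x → app G ψ x ≡ app G φ (app G χ x)) →
     ∀ y → app H (F ψ) y ≡ app H (F φ) (app H (F χ) y)) ×
  (∀ φ χ → (∀ y → app H (F φ) y ≡ app H (F χ) y) → ∀ x → app G φ x ≡ app G χ x) ×
  (∀ ψ → Σ (Aut G) λ φ → ∀ y → app H (F φ) y ≡ app H ψ y)

SameVOrbit : (G : Graph) → Fin (n G) → Fin (n G) → Set
SameVOrbit G x y = Σ (Aut G) λ φ → app G φ x ≡ y

Edge : Graph → Set
Edge G = Σ (Fin (n G)) λ x → Σ (Fin (n G)) λ y → x < y × Adj G x y

SameEOrbit : (G : Graph) → Edge G → Edge G → Set
SameEOrbit G (x , y , _) (x' , y' , _) =
  Σ (Aut G) λ φ → SamePair (app G φ x) (app G φ y) x' y'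

-- "the relation R on A has exactly k equivalence classes":
-- a surjection onto Fin k whose fibres are exactly the classes
HasClassCount : (A : Set) → (A → A → Set) → ℕ → Set
HasClassCount A R k = Σ (A → Fin k) λ f →
  (∀ j → Σ A λ a → f a ≡ j) × (∀ a b → (f a ≡ f b) ⇔ R a b)

VOrbitCount : Graph → ℕ → Set
VOrbitCount G = HasClassCount (Fin (n G)) (SameVOrbit G)

EOrbitCount : Graph → ℕ → Set
EOrbitCount G = HasClassCount (Edge G) (SameEOrbit G)

InEdgeOrbit : (G : Graph) → Fin (n G) → Fin (n G) → Fin (n G) → Fin (n G) → Set
InEdgeOrbit G u v x y = Σ (Aut G) λ φ → SamePair (app G φ u) (app G φ v) x y

-- Bridge construction on every edge of an edge set S (S symmetric):
-- H is (up to the identification given by ι and w) the graph obtained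
-- from G by replacing each edge xy ∈ S by a path x — w x y — w y x — y.
-- ι embeds the old vertices; w x y is the new vertex adjacent to x on
-- the path replacing xy (so w x y and w y x are the two new vertices).

record BridgeConstruction (G : Graph) (S : Fin (n G) → Fin (n G) → Set)
                          (H : Graph) : Set where
  field
    ι        : Fin (n G) → Fin (n H)
    w        : Fin (n G) → Fin (n G) → Fin (n H)
    ι-inj    : ∀ a b → ι a ≡ ι b → a ≡ b
    w-inj    : ∀ x y x' y' → S x y → S x' y' → w x y ≡ w x' y' → x ≡ x' × y ≡ y'
    w≢ι      : ∀ x y z → S x y → w x y ≢ ι z
    covers   : ∀ t → (Σ (Fin (n G)) λ z → ι z ≡ t)
                   ⊎ (Σ (Fin (n G)) λ x → Σ (Fin (n G)) λ y → S x y × w x y ≡ t)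
    adj-ιι   : ∀ a b → Adj H (ι a) (ι b) ⇔ (Adj G a b × ¬ S a b)
    adj-ιw   : ∀ a x y → S x y → Adj H (ι a) (w x y) ⇔ (a ≡ x)
    adj-ww   : ∀ x y x' y' → S x y → S x' y' →
               Adj H (w x y) (w x' y') ⇔ (x ≡ y' × y ≡ x')

{-# OPTIONS --safe #-}
-- Every edge of the orbit 𝓔 of the bridge uv is again a bridge, so G has a vertex
-- signing s whose value changes exactly across the edges of 𝓔: take for s x the parity
-- of the number of edges of 𝓔 that separate x from a chosen end. If x spans the kernel
-- of G, the kernel of B(G,𝓔) is spanned by the vector equal to (-1)^(s a) x a at each
-- old vertex a and to -(-1)^(s b) x b at the new vertex next to a on the path replacing
-- ab: the equations at new vertices force exactly this alternating shape, and at an old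
-- vertex the sign changes across 𝓔 turn its equation into (-1)^(s a) times that of G.
-- Automorphisms of G extend to B(G,𝓔); if Aut(G) ≅ Aut(B(G,𝓔)), finiteness makes every
-- automorphism of B(G,𝓔) an extension. Then old vertices and old edges keep their
-- orbits, the middle edges of the new paths form the single orbit replacing 𝓔, and the
-- new vertices, like the new edges at old vertices, split into as many orbits as there
-- are orbits of ordered pairs (p , q) with pq ∈ 𝓔: one if some automorphism swaps u and
-- v, two otherwise.

module Submission where

open import Defs hiding (sym)

open import Algebra.Bundles using (CommutativeMonoid; CommutativeRing)
open import Data.Bool using (Bool; true; false; if_then_else_; not; _∧_; _xor_)
import Data.Bool.Properties as Bool
open import Data.Empty using (⊥-elim)
open import Data.Fin
  using (Fin; zero; suc; _<_; _↑ˡ_; _↑ʳ_; splitAt; join; punchOut; combine; remQuot;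
         funToFin; finToFun)
open import Data.Fin.Permutation using (permutation; inverseˡ; inverseʳ)
import Data.Fin.Permutation as Perm
open import Data.Fin.Properties
  using (_≟_; _<?_; <-cmp; any?; all?; suc-injective; punchOut-injective;
         injective⇒≤; cantor-schröder-bernstein; finToFun-funToFin; funToFin-finToFin;
         remQuot-combine; combine-remQuot; ↑ˡ-injective; ↑ʳ-injective;
         splitAt-↑ˡ; splitAt-↑ʳ; join-splitAt)
open import Data.Fin.Subset.Properties using (anySubset?)
open import Data.Nat as ℕ using (ℕ; zero; suc; _+_)
import Data.Nat.Properties as ℕ
open import Data.Product using (Σ; _×_; _,_; proj₁; proj₂; ∃)
open import Data.Product.Function.NonDependent.Propositional using (_×-⇔_)
open import Data.Product.Properties using (×-≡,≡←≡)
open import Data.Rational using (ℚ; 0ℚ; 1ℚ; -_) renaming (_+_ to _+ℚ_; _*_ to _*ℚ_)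
import Data.Rational.Properties as ℚ
open import Data.Sum using (_⊎_; inj₁; inj₂; [_,_])
open import Data.Sum.Relation.Binary.Pointwise using (Pointwise; inj₁; inj₂)
open import Data.Vec using (lookup; tabulate)
open import Data.Vec.Properties using (lookup∘tabulate)
open import Function using (_∘_; _⇔_; mk⇔; Equivalence; case_of_)
open import Function.Construct.Composition using (_⇔-∘_)
open import Function.Construct.Symmetry using (⇔-sym)
open import Function.Definitions using (Injective)
open import Relation.Binary.Definitions using (tri<; tri≈; tri>)
open import Relation.Binary.PropositionalEquality
  using (_≡_; _≢_; _≗_; refl; sym; trans; cong; cong₂; subst; subst₂; module ≡-Reasoning)
open import Relation.Nullary using (¬_; ¬?; Dec; yes; no; does; contradiction)
open import Relation.Nullary.Decidable
  using (_×-dec_; _→-dec_; dec-true; dec-false; does-⇔; ¬¬-excluded-middle)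
open import Relation.Unary using (Decidable)

open import Algebra.Properties.Group ℚ.+-0-group using (inverseʳ-unique; ⁻¹-injective)
open import Algebra.Properties.CommutativeSemigroup
  (CommutativeMonoid.commutativeSemigroup ℚ.+-0-commutativeMonoid) using (interchange)
open import Algebra.Properties.CommutativeSemigroup
  (CommutativeMonoid.commutativeSemigroup ℚ.*-1-commutativeMonoid) using (x∙yz≈y∙xz)
open import Algebra.Properties.CommutativeSemigroup
  (CommutativeMonoid.commutativeSemigroup
    (CommutativeRing.+-commutativeMonoid Bool.xor-∧-commutativeRing))
  using () renaming (interchange to xor-interchange)

injective⇒surjective : ∀ {m} (f : Fin m → Fin m) → Injective _≡_ _≡_ f →
                       ∀ j → ∃ λ i → f i ≡ j
injective⇒surjective {suc m} f f-inj j with any? (λ i → f i ≟ j)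
... | yes hit  = hit
... | no  miss = contradiction (injective⇒≤ g-inj) ℕ.1+n≰n
  where
  j≢f : ∀ i → j ≢ f i
  j≢f i e = miss (i , sym e)
  g : Fin (suc m) → Fin m
  g i = punchOut (j≢f i)
  g-inj : Injective _≡_ _≡_ g
  g-inj e = f-inj (punchOut-injective (j≢f _) (j≢f _) e)

record Enumeration {m : ℕ} (P : Fin m → Set) : Set where
  field
    size          : ℕ
    element       : Fin size → Fin m
    index         : ∀ i → P i → Fin size
    element-P     : ∀ j → P (element j)
    element-index : ∀ i p → element (index i p) ≡ i
    index-element : ∀ j p → index (element j) p ≡ j

enumerate : ∀ {m} {P : Fin m → Set} → Decidable P → Enumeration P
enumerate {zero} P? = record
  { size = 0 ; element = λ () ; index = λ () ; element-P = λ ()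
  ; element-index = λ () ; index-element = λ () }
enumerate {suc m} {P} P? with P? zero | enumerate (P? ∘ suc)
... | yes p₀ | E = record
  { size = suc size ; element = el ; index = ix ; element-P = el-P
  ; element-index = el-ix ; index-element = ix-el }
  where
  open Enumeration E
  el : Fin (suc size) → Fin (suc m)
  el zero    = zero
  el (suc j) = suc (element j)
  ix : ∀ i → P i → Fin (suc size)
  ix zero    _ = zero
  ix (suc i) p = suc (index i p)
  el-P : ∀ j → P (el j)
  el-P zero    = p₀
  el-P (suc j) = element-P j
  el-ix : ∀ i p → el (ix i p) ≡ i
  el-ix zero    _ = refl
  el-ix (suc i) p = cong suc (element-index i p)
  ix-el : ∀ j p → ix (el j) p ≡ j
  ix-el zero    _ = refl
  ix-el (suc j) p = cong suc (index-element j p)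
... | no ¬p₀ | E = record
  { size = size ; element = suc ∘ element ; index = ix ; element-P = element-P
  ; element-index = el-ix ; index-element = index-element }
  where
  open Enumeration E
  ix : ∀ i → P i → Fin size
  ix zero    p = contradiction p ¬p₀
  ix (suc i) p = index i p
  el-ix : ∀ i p → suc (element (ix i p)) ≡ i
  el-ix zero    p = contradiction p ¬p₀
  el-ix (suc i) p = cong suc (element-index i p)

¬¬-∀-Fin : ∀ m {A : Fin m → Set} → (∀ i → ¬ ¬ A i) → ¬ ¬ (∀ i → A i)
¬¬-∀-Fin zero    _  k = k λ ()
¬¬-∀-Fin (suc m) ¬¬A k = ¬¬A zero λ a₀ → ¬¬-∀-Fin m (¬¬A ∘ suc) λ rest →
  k λ { zero → a₀ ; (suc i) → rest i }

funToFin-cong : ∀ {m k} {f g : Fin m → Fin k} → f ≗ g → funToFin f ≡ funToFin g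
funToFin-cong {zero}  _   = refl
funToFin-cong {suc m} f≗g = cong₂ combine (f≗g zero) (funToFin-cong (f≗g ∘ suc))

ΣQ-cong : ∀ m {f g : Fin m → ℚ} → f ≗ g → ΣQ m f ≡ ΣQ m g
ΣQ-cong zero    _   = refl
ΣQ-cong (suc m) f≗g = cong₂ _+ℚ_ (f≗g zero) (ΣQ-cong m (f≗g ∘ suc))

ΣQ-zero : ∀ m {f : Fin m → ℚ} → (∀ i → f i ≡ 0ℚ) → ΣQ m f ≡ 0ℚ
ΣQ-zero zero    _  = refl
ΣQ-zero (suc m) f0 = cong₂ _+ℚ_ (f0 zero) (ΣQ-zero m (f0 ∘ suc))

ΣQ-+ : ∀ m (f g : Fin m → ℚ) → ΣQ m (λ i → f i +ℚ g i) ≡ ΣQ m f +ℚ ΣQ m g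
ΣQ-+ zero    f g = sym (ℚ.+-identityˡ 0ℚ)
ΣQ-+ (suc m) f g = trans (cong (f zero +ℚ g zero +ℚ_) (ΣQ-+ m (f ∘ suc) (g ∘ suc)))
  (interchange (f zero) (g zero) (ΣQ m (f ∘ suc)) (ΣQ m (g ∘ suc)))

ΣQ-* : ∀ m c (f : Fin m → ℚ) → ΣQ m (λ i → c *ℚ f i) ≡ c *ℚ ΣQ m f
ΣQ-* zero    c f = sym (ℚ.*-zeroʳ c)
ΣQ-* (suc m) c f = trans (cong (c *ℚ f zero +ℚ_) (ΣQ-* m c (f ∘ suc)))
  (sym (ℚ.*-distribˡ-+ c (f zero) (ΣQ m (f ∘ suc))))

ΣQ-single : ∀ m (f : Fin m → ℚ) z → (∀ i → i ≢ z → f i ≡ 0ℚ) → ΣQ m f ≡ f z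
ΣQ-single (suc m) f zero    f0 =
  trans (cong (f zero +ℚ_) (ΣQ-zero m (λ i → f0 (suc i) λ ()))) (ℚ.+-identityʳ (f zero))
ΣQ-single (suc m) f (suc z) f0 = trans (cong₂ _+ℚ_ (f0 zero λ ())
  (ΣQ-single m (f ∘ suc) z λ i i≢z → f0 (suc i) (i≢z ∘ suc-injective)))
  (ℚ.+-identityˡ (f (suc z)))

ΣQ-swap : ∀ m k (f : Fin m → Fin k → ℚ) →
          ΣQ m (λ i → ΣQ k (f i)) ≡ ΣQ k (λ j → ΣQ m (λ i → f i j))
ΣQ-swap zero    k f = sym (ΣQ-zero k λ _ → refl)
ΣQ-swap (suc m) k f = trans (cong (ΣQ k (f zero) +ℚ_) (ΣQ-swap m k (f ∘ suc)))
  (sym (ΣQ-+ k (f zero) λ j → ΣQ m (λ i → f (suc i) j)))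

when : Bool → ℚ → ℚ
when b q = if b then q else 0ℚ

ΣQ-when : ∀ m b (f : Fin m → ℚ) → ΣQ m (λ i → when b (f i)) ≡ when b (ΣQ m f)
ΣQ-when m true  f = refl
ΣQ-when m false f = ΣQ-zero m λ _ → refl

ΣQ-reindex : ∀ {m k} (P : Fin m → Bool) (e : Fin m → Fin k) (g : Fin k → ℚ) →
  (∀ i j → P i ≡ true → P j ≡ true → e i ≡ e j → i ≡ j) →
  (∀ t → (∀ i → P i ≡ true → e i ≢ t) → g t ≡ 0ℚ) →
  ΣQ k g ≡ ΣQ m (λ i → when (P i) (g (e i)))
ΣQ-reindex {m} {k} P e g e-inj outside = begin
  ΣQ k g                                          ≡⟨ ΣQ-cong k fibre ⟩
  ΣQ k (λ t → ΣQ m (λ i → hit i t (g t)))         ≡⟨ ΣQ-swap k m _ ⟩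
  ΣQ m (λ i → ΣQ k (λ t → hit i t (g t)))         ≡⟨ ΣQ-cong m (λ i → ΣQ-when k (P i) _) ⟩
  ΣQ m (λ i → when (P i) (ΣQ k (λ t → when (does (e i ≟ t)) (g t))))
    ≡⟨ ΣQ-cong m (λ i → cong (when (P i)) (trans
         (ΣQ-single k _ (e i) λ t e≢t → miss-zero (e i ≟ t) (e≢t ∘ sym))
         (cong (λ b → when b (g (e i))) (dec-true (e i ≟ e i) refl)))) ⟩
  ΣQ m (λ i → when (P i) (g (e i)))               ∎
  where
  open ≡-Reasoning
  hit : Fin m → Fin k → ℚ → ℚ
  hit i t q = when (P i) (when (does (e i ≟ t)) q)
  miss-zero : ∀ {A : Set} (d : Dec A) {q} → ¬ A → when (does d) q ≡ 0ℚ
  miss-zero (yes a) ¬a = contradiction a ¬a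
  miss-zero (no _)  _  = refl
  hit-zero : ∀ i t q → ¬ (P i ≡ true × e i ≡ t) → hit i t q ≡ 0ℚ
  hit-zero i t q ¬hit with P i
  ... | false = refl
  ... | true  = miss-zero (e i ≟ t) λ eq → ¬hit (refl , eq)
  fibre : ∀ t → g t ≡ ΣQ m (λ i → hit i t (g t))
  fibre t with any? (λ i → (P i Bool.≟ true) ×-dec (e i ≟ t))
  ... | yes (i , Pi , refl) = sym (trans
        (ΣQ-single m _ i λ j j≢i → hit-zero j (e i) (g (e i)) λ (Pj , eq) →
           j≢i (e-inj j i Pj Pi eq))
        (found (P i) Pi))
    where
    found : ∀ b → b ≡ true → when b (when (does (e i ≟ e i)) (g (e i))) ≡ g (e i)
    found _ refl = cong (λ b → when b (g (e i))) (dec-true (e i ≟ e i) refl)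
  ... | no miss = trans (outside t λ i Pi eq → miss (i , Pi , eq))
        (sym (ΣQ-zero m λ i → hit-zero i t (g t) λ (Pi , eq) → miss (i , Pi , eq)))

AdjMul-cong : ∀ G {f g : Fin (n G) → ℚ} a → (∀ b → Adj G a b → f b ≡ g b) →
              AdjMul G f a ≡ AdjMul G g a
AdjMul-cong G {f} {g} a f≡g = ΣQ-cong (n G) term
  where
  term : ∀ b → when (adj G a b) (f b) ≡ when (adj G a b) (g b)
  term b with adj G a b in ab
  ... | true  = f≡g b ab
  ... | false = refl

AdjMul-* : ∀ G c (f : Fin (n G) → ℚ) a → AdjMul G (λ b → c *ℚ f b) a ≡ c *ℚ AdjMul G f a
AdjMul-* G c f a = trans (ΣQ-cong (n G) term) (ΣQ-* (n G) c _)
  where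
  term : ∀ b → when (adj G a b) (c *ℚ f b) ≡ c *ℚ when (adj G a b) (f b)
  term b with adj G a b
  ... | true  = refl
  ... | false = sym (ℚ.*-zeroʳ c)

idᴬ : (G : Graph) → Aut G
idᴬ G = Perm.id , λ _ _ → refl

compᴬ : (G : Graph) → Aut G → Aut G → Aut G
compᴬ G (φ , φ-adj) (χ , χ-adj) = χ Perm.∘ₚ φ , λ x y → trans (φ-adj _ _) (χ-adj x y)

invᴬ : (G : Graph) → Aut G → Aut G
invᴬ G (φ , φ-adj) = Perm.flip φ , λ x y →
  trans (sym (φ-adj _ _)) (cong₂ (adj G) (inverseʳ φ) (inverseʳ φ))

app-invᴬˡ : ∀ G φ x → app G (invᴬ G φ) (app G φ x) ≡ x
app-invᴬˡ G (φ , _) x = inverseˡ φ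

app-invᴬʳ : ∀ G φ x → app G φ (app G (invᴬ G φ) x) ≡ x
app-invᴬʳ G (φ , _) x = inverseʳ φ

app-injective : ∀ G φ → Injective _≡_ _≡_ (app G φ)
app-injective G φ {x} {y} e =
  trans (sym (app-invᴬˡ G φ x)) (trans (cong (app G (invᴬ G φ)) e) (app-invᴬˡ G φ y))

app-adj : ∀ G φ x y → adj G (app G φ x) (app G φ y) ≡ adj G x y
app-adj G (_ , φ-adj) = φ-adj

IsAutFun : (G : Graph) → (Fin (n G) → Fin (n G)) → Set
IsAutFun G f = (∀ i j → f i ≡ f j → i ≡ j) × (∀ x y → adj G (f x) (f y) ≡ adj G x y)

isAutFun? : ∀ G f → Dec (IsAutFun G f)
isAutFun? G f =
  all? (λ i → all? λ j → (f i ≟ f j) →-dec (i ≟ j)) ×-dec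
  all? (λ x → all? λ y → adj G (f x) (f y) Bool.≟ adj G x y)

IsAutFun-resp : ∀ G {f g} → f ≗ g → IsAutFun G f → IsAutFun G g
IsAutFun-resp G f≗g (f-inj , f-adj) =
  (λ i j e → f-inj i j (trans (f≗g i) (trans e (sym (f≗g j))))) ,
  (λ x y → trans (cong₂ (adj G) (sym (f≗g x)) (sym (f≗g y))) (f-adj x y))

app-isAutFun : ∀ G φ → IsAutFun G (app G φ)
app-isAutFun G φ = (λ _ _ → app-injective G φ) , app-adj G φ

fromAutFun : ∀ G f → IsAutFun G f → Aut G
fromAutFun G f (f-inj , f-adj) = permutation f f⁻¹ f∘f⁻¹ f⁻¹∘f , f-adj
  where
  f⁻¹ : Fin (n G) → Fin (n G)
  f⁻¹ j = proj₁ (injective⇒surjective f (f-inj _ _) j)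
  f∘f⁻¹ : ∀ j → f (f⁻¹ j) ≡ j
  f∘f⁻¹ j = proj₂ (injective⇒surjective f (f-inj _ _) j)
  f⁻¹∘f : ∀ x → f⁻¹ (f x) ≡ x
  f⁻¹∘f x = f-inj _ _ (f∘f⁻¹ (f x))

module AutCode (G : Graph) where

  private
    Code : Set
    Code = Fin (n G ℕ.^ n G)

    decode : Code → Fin (n G) → Fin (n G)
    decode = finToFun

    encode : (Fin (n G) → Fin (n G)) → Code
    encode = funToFin

    encode-decode : ∀ c → encode (decode c) ≡ c
    encode-decode = funToFin-finToFin {n G} {n G}

    code : Aut G → Code
    code φ = encode (app G φ)

    decode-code : ∀ φ → decode (code φ) ≗ app G φ
    decode-code φ = finToFun-funToFin (app G φ)

    code-isAutFun : ∀ φ → IsAutFun G (decode (code φ))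
    code-isAutFun φ = IsAutFun-resp G (sym ∘ decode-code φ) (app-isAutFun G φ)

    code-injective : ∀ φ χ → code φ ≡ code χ → app G φ ≗ app G χ
    code-injective φ χ e x =
      trans (sym (decode-code φ x)) (trans (cong (λ c → decode c x) e) (decode-code χ x))

  ∃Aut? : ∀ {Q : (Fin (n G) → Fin (n G)) → Set} → (∀ f → Dec (Q f)) →
          (∀ {f g} → f ≗ g → Q f → Q g) → Dec (∃ λ φ → Q (app G φ))
  ∃Aut? Q? Q-resp with any? (λ c → isAutFun? G (decode c) ×-dec Q? (decode c))
  ... | yes (c , aut , q) = yes (fromAutFun G _ aut , q)
  ... | no none           = no λ (φ , q) →
    none (code φ , code-isAutFun φ , Q-resp (sym ∘ decode-code φ) q)

  -- θ is transported to the finite set of codes, fixing the codes of non-automorphisms.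
  Aut-injective⇒surjective : (θ : Aut G → Aut G) →
    (∀ φ χ → app G (θ φ) ≗ app G (θ χ) → app G φ ≗ app G χ) →
    ∀ χ → ∃ λ φ → app G (θ φ) ≗ app G χ
  Aut-injective⇒surjective θ θ-inj χ = from-preimage c (isAutFun? G (decode c)) θ̂c≡χ
    where
    θ̂′ : (c : Code) → Dec (IsAutFun G (decode c)) → Code
    θ̂′ c (yes aut) = code (θ (fromAutFun G (decode c) aut))
    θ̂′ c (no _)    = c
    θ̂ : Code → Code
    θ̂ c = θ̂′ c (isAutFun? G (decode c))
    θ̂′-injective : ∀ c c′ d d′ → θ̂′ c d ≡ θ̂′ c′ d′ → c ≡ c′
    θ̂′-injective c c′ (yes aut) (yes aut′) e = begin
      c                  ≡⟨ encode-decode c ⟨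
      encode (decode c)  ≡⟨ funToFin-cong (θ-inj φ φ′ (code-injective (θ φ) (θ φ′) e)) ⟩
      encode (decode c′) ≡⟨ encode-decode c′ ⟩
      c′                 ∎
      where
      open ≡-Reasoning
      φ φ′ : Aut G
      φ  = fromAutFun G (decode c) aut
      φ′ = fromAutFun G (decode c′) aut′
    θ̂′-injective c c′ (yes aut) (no ¬aut′) e = contradiction
      (subst (IsAutFun G ∘ decode) e (code-isAutFun (θ (fromAutFun G (decode c) aut)))) ¬aut′
    θ̂′-injective c c′ (no ¬aut) (yes aut′) e = contradiction
      (subst (IsAutFun G ∘ decode) (sym e) (code-isAutFun (θ (fromAutFun G (decode c′) aut′))))
      ¬aut
    θ̂′-injective c c′ (no _) (no _) e = e
    θ̂-injective : Injective _≡_ _≡_ θ̂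
    θ̂-injective {c} {c′} = θ̂′-injective c c′ (isAutFun? G (decode c)) (isAutFun? G (decode c′))
    c : Code
    c = proj₁ (injective⇒surjective θ̂ θ̂-injective (code χ))
    θ̂c≡χ : θ̂ c ≡ code χ
    θ̂c≡χ = proj₂ (injective⇒surjective θ̂ θ̂-injective (code χ))
    from-preimage : ∀ c (d : Dec (IsAutFun G (decode c))) → θ̂′ c d ≡ code χ →
                    ∃ λ φ → app G (θ φ) ≗ app G χ
    from-preimage c (yes aut) e =
      fromAutFun G (decode c) aut , code-injective (θ (fromAutFun G (decode c) aut)) χ e
    from-preimage c (no ¬aut) e =
      contradiction (subst (IsAutFun G ∘ decode) (sym e) (code-isAutFun χ)) ¬aut

open AutCode using (∃Aut?; Aut-injective⇒surjective)

module _ {m : ℕ} {R : Fin m → Fin m → Set} where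

  Reach-++ : ∀ {a b c} → Reach R a b → Reach R b c → Reach R a c
  Reach-++ here       r′ = r′
  Reach-++ (step e r) r′ = step e (Reach-++ r r′)

  Reach-reverse : (∀ {a b} → R a b → R b a) → ∀ {a b} → Reach R a b → Reach R b a
  Reach-reverse R-sym here       = here
  Reach-reverse R-sym (step e r) = Reach-++ (Reach-reverse R-sym r) (step (R-sym e) here)

module _ {m : ℕ} {R R′ : Fin m → Fin m → Set} where

  Reach-map : (f : Fin m → Fin m) → (∀ {a b} → R a b → R′ (f a) (f b)) →
              ∀ {a b} → Reach R a b → Reach R′ (f a) (f b)
  Reach-map f f-hom here       = here
  Reach-map f f-hom (step e r) = step (f-hom e) (Reach-map f f-hom r)

Reach-bind : ∀ {m k} {R : Fin m → Fin m → Set} {R′ : Fin k → Fin k → Set}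
             (f : Fin m → Fin k) → (∀ {a b} → R a b → Reach R′ (f a) (f b)) →
             ∀ {a b} → Reach R a b → Reach R′ (f a) (f b)
Reach-bind f path here       = here
Reach-bind f path (step e r) = Reach-++ (path e) (Reach-bind f path r)

module _ {m : ℕ} where

  SamePair-swap : {a b c d : Fin m} → SamePair a b c d → SamePair b a c d
  SamePair-swap (inj₁ (a≡c , b≡d)) = inj₂ (b≡d , a≡c)
  SamePair-swap (inj₂ (a≡d , b≡c)) = inj₁ (b≡c , a≡d)

  SamePair-sym : {a b c d : Fin m} → SamePair a b c d → SamePair c d a b
  SamePair-sym (inj₁ (refl , refl)) = inj₁ (refl , refl)
  SamePair-sym (inj₂ (refl , refl)) = inj₂ (refl , refl)

  SamePair-trans : {a b c d e f : Fin m} → SamePair a b c d → SamePair c d e f → SamePair a b e f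
  SamePair-trans (inj₁ (refl , refl)) s = s
  SamePair-trans (inj₂ (refl , refl)) s = SamePair-swap s

  samePair? : (a b c d : Fin m) → Dec (SamePair a b c d)
  samePair? a b c d with (a ≟ c) ×-dec (b ≟ d) | (a ≟ d) ×-dec (b ≟ c)
  ... | yes same | _           = yes (inj₁ same)
  ... | no _     | yes swapped = yes (inj₂ swapped)
  ... | no ¬same | no ¬swapped = no [ ¬same , ¬swapped ]

SamePair-map : ∀ {m k} (f : Fin m → Fin k) {a b c d} →
               SamePair a b c d → SamePair (f a) (f b) (f c) (f d)
SamePair-map f (inj₁ (refl , refl)) = inj₁ (refl , refl)
SamePair-map f (inj₂ (refl , refl)) = inj₂ (refl , refl)

Adj-sym : ∀ G {a b} → Adj G a b → Adj G b a
Adj-sym G {a} {b} e = trans (Graph.sym G b a) e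

Adj-irrefl : ∀ G {a} → ¬ Adj G a a
Adj-irrefl G {a} e with trans (sym (Graph.irrefl G a)) e
... | ()

AdjMinus-sym : ∀ G {p q a b} → AdjMinus G p q a b → AdjMinus G p q b a
AdjMinus-sym G (e , ¬pq) = Adj-sym G e , ¬pq ∘ SamePair-swap

AdjMinus-resp : ∀ G {p q p′ q′ a b} → SamePair p q p′ q′ →
                AdjMinus G p q a b → AdjMinus G p′ q′ a b
AdjMinus-resp G pq≡p′q′ (e , ¬pq) =
  e , λ ab≡p′q′ → ¬pq (SamePair-trans ab≡p′q′ (SamePair-sym pq≡p′q′))

IsBridge-aut : ∀ G φ {u v} → IsBridge G u v → IsBridge G (app G φ u) (app G φ v)
IsBridge-aut G φ {u} {v} (uv , disconnected) =
  trans (app-adj G φ u v) uv , disconnected ∘ pull-back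
  where
  ψ : Aut G
  ψ = invᴬ G φ
  ψ-hom : ∀ {c d} → AdjMinus G (app G φ u) (app G φ v) c d →
          AdjMinus G u v (app G ψ c) (app G ψ d)
  ψ-hom {c} {d} (e , ¬cd) = trans (app-adj G ψ c d) e , λ ψcd≡uv →
    ¬cd (subst₂ (λ c′ d′ → SamePair c′ d′ _ _) (app-invᴬʳ G φ c) (app-invᴬʳ G φ d)
                (SamePair-map (app G φ) ψcd≡uv))
  pull-back : ConnectedRel (n G) (AdjMinus G (app G φ u) (app G φ v)) →
              ConnectedRel (n G) (AdjMinus G u v)
  pull-back connected a b = subst₂ (Reach _) (app-invᴬˡ G φ a) (app-invᴬˡ G φ b)
    (Reach-map (app G ψ) ψ-hom (connected (app G φ a) (app G φ b)))

bridge-separates : ∀ G {u v} → Connected G → IsBridge G u v → ¬ Reach (AdjMinus G u v) u v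
bridge-separates G {u} {v} connected (_ , disconnected) u↝v =
  disconnected λ a b → Reach-bind (λ x → x) detour (connected a b)
  where
  detour : ∀ {c d} → Adj G c d → Reach (AdjMinus G u v) c d
  detour {c} {d} e with samePair? c d u v
  ... | no ¬uv                  = step (e , ¬uv) here
  ... | yes (inj₁ (refl , refl)) = u↝v
  ... | yes (inj₂ (refl , refl)) = Reach-reverse (AdjMinus-sym G) u↝v

module EdgeOrbit (G : Graph) (u v : Fin (n G)) where

  S : Fin (n G) → Fin (n G) → Set
  S = InEdgeOrbit G u v

  PairOrbit : Fin (n G) × Fin (n G) → Fin (n G) × Fin (n G) → Set
  PairOrbit (p , q) (p′ , q′) = ∃ λ φ → app G φ p ≡ p′ × app G φ q ≡ q′

  S-uv : S u v
  S-uv = idᴬ G , inj₁ (refl , refl)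

  S-vu : S v u
  S-vu = idᴬ G , inj₂ (refl , refl)

  S-sym : ∀ {x y} → S x y → S y x
  S-sym (φ , sp) = φ , SamePair-sym (SamePair-swap (SamePair-sym sp))

  S-resp : ∀ {a b c d} → SamePair a b c d → S c d → S a b
  S-resp ab≡cd (φ , sp) = φ , SamePair-trans sp (SamePair-sym ab≡cd)

  S-aut : ∀ φ {x y} → S x y → S (app G φ x) (app G φ y)
  S-aut φ (χ , sp) = compᴬ G φ χ , SamePair-map (app G φ) sp

  S? : ∀ x y → Dec (S x y)
  S? x y = ∃Aut? G (λ f → samePair? (f u) (f v) x y)
    λ f≗g → subst₂ (λ a b → SamePair a b x y) (f≗g u) (f≗g v)

  S-adj : Adj G u v → ∀ {x y} → S x y → Adj G x y
  S-adj uv (φ , inj₁ (refl , refl)) = trans (app-adj G φ u v) uv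
  S-adj uv (φ , inj₂ (refl , refl)) = Adj-sym G (trans (app-adj G φ u v) uv)

  S-oriented : ∀ {p q} → S p q → PairOrbit (u , v) (p , q) ⊎ PairOrbit (v , u) (p , q)
  S-oriented (φ , inj₁ (φu≡p , φv≡q)) = inj₁ (φ , φu≡p , φv≡q)
  S-oriented (φ , inj₂ (φu≡q , φv≡p)) = inj₂ (φ , φv≡p , φu≡q)

  S-separates : Connected G → IsBridge G u v → ∀ {p q} → S p q → ¬ Reach (AdjMinus G p q) p q
  S-separates connected bridge (φ , sp) p↝q =
    bridge-separates G connected (IsBridge-aut G φ bridge)
      (oriented sp (Reach-map (λ a → a) (AdjMinus-resp G (SamePair-sym sp)) p↝q))
    where
    oriented : ∀ {a b p q} → SamePair a b p q →
               Reach (AdjMinus G a b) p q → Reach (AdjMinus G a b) a b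
    oriented (inj₁ (refl , refl)) r = r
    oriented (inj₂ (refl , refl)) r = Reach-reverse (AdjMinus-sym G) r

  Swap : Set
  Swap = PairOrbit (u , v) (v , u)

  -- Representatives of the orbits of ordered pairs (p , q) with pq ∈ 𝓔; they index
  -- both the orbits of new vertices and those of new edges ι p — w p q.
  record OrbitRepresentatives (r : ℕ) : Set where
    field
      rep          : Fin r → Fin (n G) × Fin (n G)
      rep-S        : ∀ i → S (proj₁ (rep i)) (proj₂ (rep i))
      rep-distinct : ∀ i j → PairOrbit (rep i) (rep j) → i ≡ j
      rep-covers   : ∀ {p q} → S p q → ∃ λ i → PairOrbit (rep i) (p , q)

  representatives-swap : Swap → OrbitRepresentatives 1
  representatives-swap (σ , σu≡v , σv≡u) = record
    { rep          = λ _ → u , v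
    ; rep-S        = λ _ → S-uv
    ; rep-distinct = λ { zero zero _ → refl }
    ; rep-covers   = λ s → zero , oriented (S-oriented s)
    }
    where
    oriented : ∀ {p q} → PairOrbit (u , v) (p , q) ⊎ PairOrbit (v , u) (p , q) →
               PairOrbit (u , v) (p , q)
    oriented (inj₁ uv↦pq) = uv↦pq
    oriented (inj₂ (φ , φv≡p , φu≡q)) =
      compᴬ G φ σ , trans (cong (app G φ) σu≡v) φv≡p , trans (cong (app G φ) σv≡u) φu≡q

  representatives-no-swap : ¬ Swap → OrbitRepresentatives 2
  representatives-no-swap no-swap = record
    { rep = rep ; rep-S = rep-S ; rep-distinct = rep-distinct ; rep-covers = rep-covers }
    where
    rep : Fin 2 → Fin (n G) × Fin (n G)
    rep zero    = u , v
    rep (suc _) = v , u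
    rep-S : ∀ i → S (proj₁ (rep i)) (proj₂ (rep i))
    rep-S zero    = S-uv
    rep-S (suc _) = S-vu
    rep-distinct : ∀ i j → PairOrbit (rep i) (rep j) → i ≡ j
    rep-distinct zero       zero       _                 = refl
    rep-distinct (suc zero) (suc zero) _                 = refl
    rep-distinct zero       (suc zero) swap              = contradiction swap no-swap
    rep-distinct (suc zero) zero       (φ , φv≡u , φu≡v) = contradiction (φ , φu≡v , φv≡u) no-swap
    rep-covers : ∀ {p q} → S p q → ∃ λ i → PairOrbit (rep i) (p , q)
    rep-covers s with S-oriented s
    ... | inj₁ uv↦pq = zero , uv↦pq
    ... | inj₂ vu↦pq = suc zero , vu↦pq

⨁ : ∀ m → (Fin m → Bool) → Bool
⨁ zero    f = false
⨁ (suc m) f = f zero xor ⨁ m (f ∘ suc)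

⨁-cong : ∀ m {f g : Fin m → Bool} → f ≗ g → ⨁ m f ≡ ⨁ m g
⨁-cong zero    _   = refl
⨁-cong (suc m) f≗g = cong₂ _xor_ (f≗g zero) (⨁-cong m (f≗g ∘ suc))

⨁-xor : ∀ m (f g : Fin m → Bool) → ⨁ m f xor ⨁ m g ≡ ⨁ m (λ i → f i xor g i)
⨁-xor zero    f g = refl
⨁-xor (suc m) f g = trans (xor-interchange (f zero) (⨁ m (f ∘ suc)) (g zero) (⨁ m (g ∘ suc)))
  (cong ((f zero xor g zero) xor_) (⨁-xor m (f ∘ suc) (g ∘ suc)))

⨁-false : ∀ m {f : Fin m → Bool} → (∀ i → f i ≡ false) → ⨁ m f ≡ false
⨁-false zero    _  = refl
⨁-false (suc m) f0 = cong₂ _xor_ (f0 zero) (⨁-false m (f0 ∘ suc))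

⨁-single : ∀ m (f : Fin m → Bool) z → (∀ i → i ≢ z → f i ≡ false) → ⨁ m f ≡ f z
⨁-single (suc m) f zero    f0 =
  trans (cong (f zero xor_) (⨁-false m λ i → f0 (suc i) λ ())) (Bool.xor-identityʳ (f zero))
⨁-single (suc m) f (suc z) f0 = cong₂ _xor_ (f0 zero λ ())
  (⨁-single m (f ∘ suc) z λ i i≢z → f0 (suc i) (i≢z ∘ suc-injective))

⨁² : ∀ m → (Fin m → Fin m → Bool) → Bool
⨁² m h = ⨁ m λ p → ⨁ m (h p)

⨁²-cong : ∀ m {h h′ : Fin m → Fin m → Bool} → (∀ p q → h p q ≡ h′ p q) → ⨁² m h ≡ ⨁² m h′
⨁²-cong m h≗h′ = ⨁-cong m λ p → ⨁-cong m (h≗h′ p)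

⨁²-xor : ∀ m (h h′ : Fin m → Fin m → Bool) →
         ⨁² m h xor ⨁² m h′ ≡ ⨁² m (λ p q → h p q xor h′ p q)
⨁²-xor m h h′ = trans (⨁-xor m _ _) (⨁-cong m λ p → ⨁-xor m (h p) (h′ p))

⨁²-single : ∀ m (h : Fin m → Fin m → Bool) x y → (∀ p q → ¬ (p ≡ x × q ≡ y) → h p q ≡ false) →
            ⨁² m h ≡ h x y
⨁²-single m h x y h0 =
  trans (⨁-single m _ x λ p p≢x → ⨁-false m λ q → h0 p q (p≢x ∘ proj₁))
        (⨁-single m _ y λ q q≢y → h0 x q (q≢y ∘ proj₂))

module Signing (G : Graph) {S : Fin (n G) → Fin (n G) → Set} (S? : ∀ x y → Dec (S x y))
               (S-sym : ∀ {x y} → S x y → S y x)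
               (S-separates : ∀ {p q} → S p q → ¬ Reach (AdjMinus G p q) p q) where

  IsSigning : (Fin (n G) → Bool) → Set
  IsSigning s = ∀ x y → Adj G x y → s x xor s y ≡ does (S? x y)

  isSigning? : ∀ s → Dec (IsSigning s)
  isSigning? s = all? λ x → all? λ y →
    (adj G x y Bool.≟ true) →-dec ((s x xor s y) Bool.≟ does (S? x y))

  IsSigning-resp : ∀ {s s′} → s ≗ s′ → IsSigning s → IsSigning s′
  IsSigning-resp s≗s′ ok x y e = trans (sym (cong₂ _xor_ (s≗s′ x) (s≗s′ y))) (ok x y e)

  module Cut (reach? : ∀ p q x → Dec (Reach (AdjMinus G p q) p x)) where

    far : Fin (n G) → Fin (n G) → Fin (n G) → Bool
    far p q x = not (does (reach? p q x))

    far-edge : ∀ {p q x y} → S p q → Adj G x y →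
               far p q x xor far p q y ≡ does (samePair? x y p q)
    far-edge {p} {q} {x} {y} s e with samePair? x y p q
    ... | yes (inj₁ (refl , refl))
      rewrite dec-true (reach? p q p) here | dec-false (reach? p q q) (S-separates s) = refl
    ... | yes (inj₂ (refl , refl))
      rewrite dec-true (reach? p q p) here | dec-false (reach? p q q) (S-separates s) = refl
    ... | no ¬pq = trans (cong (λ b → not b xor far p q y) same-side) (Bool.xor-same (far p q y))
      where
      same-side : does (reach? p q x) ≡ does (reach? p q y)
      same-side = does-⇔
        (mk⇔ (λ r → Reach-++ r (step (e , ¬pq) here))
             (λ r → Reach-++ r (step (AdjMinus-sym G (e , ¬pq)) here)))
        (reach? p q x) (reach? p q y)

    chosen : Fin (n G) → Fin (n G) → Bool
    chosen p q = does (S? p q) ∧ does (p <? q)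

    -- The parity of the number of edges pq of S (each taken once, with p < q)
    -- whose removal separates x from p.
    cut : Fin (n G) → Bool
    cut x = ⨁² (n G) λ p q → chosen p q ∧ far p q x

    chosen-pair< : ∀ {x y} → x < y →
                   ⨁² (n G) (λ p q → chosen p q ∧ does (samePair? x y p q)) ≡ does (S? x y)
    chosen-pair< {x} {y} x<y = trans (⨁²-single (n G) _ x y off-diagonal) at-xy
      where
      off-diagonal : ∀ p q → ¬ (p ≡ x × q ≡ y) → chosen p q ∧ does (samePair? x y p q) ≡ false
      off-diagonal p q ¬xy with samePair? x y p q
      ... | no _ = Bool.∧-zeroʳ (chosen p q)
      ... | yes (inj₁ (refl , refl)) = contradiction (refl , refl) ¬xy
      ... | yes (inj₂ (refl , refl))
        rewrite dec-false (p <? q) (ℕ.<-asym x<y) = cong (_∧ true) (Bool.∧-zeroʳ (does (S? p q)))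
      at-xy : chosen x y ∧ does (samePair? x y x y) ≡ does (S? x y)
      at-xy rewrite dec-true (samePair? x y x y) (inj₁ (refl , refl)) | dec-true (x <? y) x<y =
        trans (Bool.∧-identityʳ _) (Bool.∧-identityʳ _)

    chosen-pair : ∀ {x y} → x ≢ y →
                  ⨁² (n G) (λ p q → chosen p q ∧ does (samePair? x y p q)) ≡ does (S? x y)
    chosen-pair {x} {y} x≢y with <-cmp x y
    ... | tri< x<y _ _ = chosen-pair< x<y
    ... | tri≈ _ x≡y _ = contradiction x≡y x≢y
    ... | tri> _ _ y<x = begin
      ⨁² (n G) (λ p q → chosen p q ∧ does (samePair? x y p q))
        ≡⟨ ⨁²-cong (n G) (λ p q → cong (chosen p q ∧_)
             (does-⇔ (mk⇔ SamePair-swap SamePair-swap) (samePair? x y p q) (samePair? y x p q))) ⟩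
      ⨁² (n G) (λ p q → chosen p q ∧ does (samePair? y x p q))
        ≡⟨ chosen-pair< y<x ⟩
      does (S? y x)
        ≡⟨ does-⇔ (mk⇔ S-sym S-sym) (S? y x) (S? x y) ⟩
      does (S? x y) ∎
      where open ≡-Reasoning

    cut-isSigning : IsSigning cut
    cut-isSigning x y e = begin
      cut x xor cut y
        ≡⟨ ⨁²-xor (n G) _ _ ⟩
      ⨁² (n G) (λ p q → (chosen p q ∧ far p q x) xor (chosen p q ∧ far p q y))
        ≡⟨ ⨁²-cong (n G) (λ p q →
             trans (sym (Bool.∧-distribˡ-xor (chosen p q) _ _)) (crossing p q (S? p q))) ⟩
      ⨁² (n G) (λ p q → chosen p q ∧ does (samePair? x y p q))
        ≡⟨ chosen-pair (λ { refl → Adj-irrefl G e }) ⟩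
      does (S? x y) ∎
      where
      open ≡-Reasoning
      crossing : ∀ p q (d : Dec (S p q)) →
        (does d ∧ does (p <? q)) ∧ (far p q x xor far p q y) ≡
        (does d ∧ does (p <? q)) ∧ does (samePair? x y p q)
      crossing p q (yes s) = cong (does (p <? q) ∧_) (far-edge s e)
      crossing p q (no _)  = refl

  -- Reachability in G − pq is never decided: a signing exists decidably (there are
  -- finitely many Boolean vectors), so it suffices to refute its absence, and under
  -- that hypothesis excluded middle is available for each reachability question.
  signing : ∃ IsSigning
  signing with anySubset? (λ sub → isSigning? (lookup sub))
  ... | yes (sub , ok) = lookup sub , ok
  ... | no none = ⊥-elim (¬¬signing λ (s , ok) →
          none (tabulate s , IsSigning-resp (sym ∘ lookup∘tabulate s) ok))
    where
    ¬¬signing : ¬ ¬ ∃ IsSigning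
    ¬¬signing no-signing =
      ¬¬-∀-Fin (n G) (λ p → ¬¬-∀-Fin (n G) λ q → ¬¬-∀-Fin (n G) λ x → ¬¬-excluded-middle)
        λ reach? → no-signing (Cut.cut reach? , Cut.cut-isSigning reach?)

σ : Bool → ℚ
σ false = 1ℚ
σ true  = - 1ℚ

σ-xor : ∀ a b → σ (a xor b) ≡ σ a *ℚ σ b
σ-xor false false = refl
σ-xor false true  = refl
σ-xor true  false = refl
σ-xor true  true  = refl

σ-*-σ : ∀ a b q → σ a *ℚ (σ b *ℚ q) ≡ σ (a xor b) *ℚ q
σ-*-σ a b q = trans (sym (ℚ.*-assoc (σ a) (σ b) q)) (cong (_*ℚ q) (sym (σ-xor a b)))

σ-involutive : ∀ b q → σ b *ℚ (σ b *ℚ q) ≡ q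
σ-involutive b q =
  trans (σ-*-σ b b q) (trans (cong (λ c → σ c *ℚ q) (Bool.xor-same b)) (ℚ.*-identityˡ q))

σ-true : ∀ q → σ true *ℚ q ≡ - q
σ-true q = trans (sym (ℚ.neg-distribˡ-* 1ℚ q)) (cong -_ (ℚ.*-identityˡ q))

σ*-≢0 : ∀ b {q} → q ≢ 0ℚ → σ b *ℚ q ≢ 0ℚ
σ*-≢0 b {q} q≢0 e =
  q≢0 (trans (sym (σ-involutive b q)) (trans (cong (σ b *ℚ_) e) (ℚ.*-zeroʳ (σ b))))

neg-≢0 : ∀ {q} → q ≢ 0ℚ → - q ≢ 0ℚ
neg-≢0 q≢0 e = q≢0 (⁻¹-injective e)

module Subdivision {G : Graph} {S : Fin (n G) → Fin (n G) → Set}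
                   (S? : ∀ x y → Dec (S x y)) (S-sym : ∀ {x y} → S x y → S y x)
                   (S-adj : ∀ {x y} → S x y → Adj G x y)
                   {H : Graph} (B : BridgeConstruction G S H) where

  open BridgeConstruction B

  elimVertex : {A : Set} → (Fin (n G) → A) → (Fin (n G) → Fin (n G) → A) → Fin (n H) → A
  elimVertex old new t with covers t
  ... | inj₁ (a , _)         = old a
  ... | inj₂ (p , q , _ , _) = new p q

  vertex-ind : (P : Fin (n H) → Set) → (∀ a → P (ι a)) → (∀ {p q} → S p q → P (w p q)) →
               ∀ t → P t
  vertex-ind P old new t = [ (λ (a , ιa≡t) → subst P ιa≡t (old a))
                           , (λ (_ , _ , s , wpq≡t) → subst P wpq≡t (new s)) ] (covers t)

  module _ {A : Set} (old : Fin (n G) → A) (new : Fin (n G) → Fin (n G) → A) where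

    elimVertex-ι : ∀ a → elimVertex old new (ι a) ≡ old a
    elimVertex-ι a with covers (ι a)
    ... | inj₁ (a′ , ιa′≡ιa)        = cong old (ι-inj a′ a ιa′≡ιa)
    ... | inj₂ (p , q , s , wpq≡ιa) = contradiction wpq≡ιa (w≢ι p q a s)

    elimVertex-w : ∀ {p q} → S p q → elimVertex old new (w p q) ≡ new p q
    elimVertex-w {p} {q} s with covers (w p q)
    ... | inj₁ (a , ιa≡wpq)           = contradiction (sym ιa≡wpq) (w≢ι p q a s)
    ... | inj₂ (p′ , q′ , s′ , wpq≡w) with w-inj p′ q′ p q s′ s wpq≡w
    ...   | refl , refl = refl

  ιw-adj : ∀ {p q} → S p q → Adj H (ι p) (w p q)
  ιw-adj s = Equivalence.from (adj-ιw _ _ _ s) refl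

  ww-adj : ∀ {p q} → S p q → Adj H (w p q) (w q p)
  ww-adj s = Equivalence.from (adj-ww _ _ _ _ s (S-sym s)) (refl , refl)

  -- The neighbour of ι a on the possibly subdivided edge ab.
  toward′ : ∀ a b → Dec (S a b) → Fin (n H)
  toward′ a b (yes _) = w a b
  toward′ a b (no _)  = ι b

  toward : Fin (n G) → Fin (n G) → Fin (n H)
  toward a b = toward′ a b (S? a b)

  toward-adj : ∀ a b → adj H (ι a) (toward a b) ≡ adj G a b
  toward-adj a b = Bool.⇔→≡ (along (S? a b))
    where
    along : (d : Dec (S a b)) → Adj H (ι a) (toward′ a b d) ⇔ Adj G a b
    along (yes s) = mk⇔ (λ _ → S-adj s) (λ _ → ιw-adj s)
    along (no ¬s) = mk⇔ (proj₁ ∘ Equivalence.to (adj-ιι a b))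
                        (λ e → Equivalence.from (adj-ιι a b) (e , ¬s))

  toward-injective : ∀ a {b c} → toward a b ≡ toward a c → b ≡ c
  toward-injective a {b} {c} = go (S? a b) (S? a c)
    where
    go : (d : Dec (S a b)) (d′ : Dec (S a c)) → toward′ a b d ≡ toward′ a c d′ → b ≡ c
    go (yes s) (yes s′) e = proj₂ (w-inj a b a c s s′ e)
    go (yes s) (no _)   e = contradiction e (w≢ι a b c s)
    go (no _)  (yes s′) e = contradiction (sym e) (w≢ι a c b s′)
    go (no _)  (no _)   e = ι-inj b c e

  neighbour-ι : ∀ {a t} → Adj H (ι a) t → ∃ λ b → toward a b ≡ t
  neighbour-ι {a} {t} e with covers t
  ... | inj₁ (b , refl) = b , go (S? a b)
    where
    go : (d : Dec (S a b)) → toward′ a b d ≡ ι b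
    go (yes s) = contradiction s (proj₂ (Equivalence.to (adj-ιι a b) e))
    go (no _)  = refl
  ... | inj₂ (p , q , s , refl) with Equivalence.to (adj-ιw a p q s) e
  ...   | refl = q , go (S? p q)
    where
    go : (d : Dec (S p q)) → toward′ p q d ≡ w p q
    go (yes _) = refl
    go (no ¬s) = contradiction s ¬s

  neighbour-w : ∀ {p q t} → S p q → Adj H (w p q) t → t ≡ ι p ⊎ t ≡ w q p
  neighbour-w {p} {q} {t} s e with covers t
  ... | inj₁ (a , refl) = inj₁ (cong ι (Equivalence.to (adj-ιw a p q s) (Adj-sym H e)))
  ... | inj₂ (p′ , q′ , s′ , refl) with Equivalence.to (adj-ww p q p′ q′ s s′) e
  ...   | refl , refl = inj₂ refl

  AdjMul-ι : ∀ f a → AdjMul H f (ι a) ≡ AdjMul G (f ∘ toward a) a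
  AdjMul-ι f a = trans
    (ΣQ-reindex (adj G a) (toward a) _ (λ b c _ _ → toward-injective a) outside)
    (ΣQ-cong (n G) λ b → trans (cong (λ x → when (adj G a b) (when x (f (toward a b))))
                                     (toward-adj a b))
                               (twice (adj G a b)))
    where
    outside : ∀ t → (∀ b → adj G a b ≡ true → toward a b ≢ t) →
              when (adj H (ι a) t) (f t) ≡ 0ℚ
    outside t far with adj H (ι a) t in e
    ... | false = refl
    ... | true  = let (b , b↦t) = neighbour-ι e in contradiction b↦t
                    (far b (trans (sym (toward-adj a b)) (subst (Adj H (ι a)) (sym b↦t) e)))
    twice : ∀ x {q} → when x (when x q) ≡ when x q
    twice true  = refl
    twice false = refl

  AdjMul-w : ∀ f {p q} → S p q → AdjMul H f (w p q) ≡ f (ι p) +ℚ f (w q p)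
  AdjMul-w f {p} {q} s = begin
    AdjMul H f (w p q)
      ≡⟨ ΣQ-reindex (λ _ → true) ends _ ends-injective outside ⟩
    when (adj H (w p q) (ι p)) (f (ι p)) +ℚ (when (adj H (w p q) (w q p)) (f (w q p)) +ℚ 0ℚ)
      ≡⟨ cong₂ (λ x y → when x (f (ι p)) +ℚ (when y (f (w q p)) +ℚ 0ℚ))
               (Adj-sym H (ιw-adj s)) (ww-adj s) ⟩
    f (ι p) +ℚ (f (w q p) +ℚ 0ℚ)
      ≡⟨ cong (f (ι p) +ℚ_) (ℚ.+-identityʳ (f (w q p))) ⟩
    f (ι p) +ℚ f (w q p) ∎
    where
    open ≡-Reasoning
    ends : Fin 2 → Fin (n H)
    ends zero    = ι p
    ends (suc _) = w q p
    ends-injective : ∀ i j → true ≡ true → true ≡ true → ends i ≡ ends j → i ≡ j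
    ends-injective zero          zero          _ _ _ = refl
    ends-injective (suc zero)    (suc zero)    _ _ _ = refl
    ends-injective zero          (suc zero)    _ _ e = contradiction (sym e) (w≢ι q p p (S-sym s))
    ends-injective (suc zero)    zero          _ _ e = contradiction e (w≢ι q p p (S-sym s))
    outside : ∀ t → (∀ i → true ≡ true → ends i ≢ t) → when (adj H (w p q) t) (f t) ≡ 0ℚ
    outside t far with adj H (w p q) t in e
    ... | false = refl
    ... | true with neighbour-w s e
    ...   | inj₁ t≡ιp  = contradiction (sym t≡ιp) (far zero refl)
    ...   | inj₂ t≡wqp = contradiction (sym t≡wqp) (far (suc zero) refl)

  edge-path : ∀ {a b} → Adj G a b → Reach (Adj H) (ι a) (ι b)
  edge-path {a} {b} e with S? a b
  ... | no ¬s = step (Equivalence.from (adj-ιι a b) (e , ¬s)) here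
  ... | yes s = step (ιw-adj s) (step (ww-adj s) (step (Adj-sym H (ιw-adj (S-sym s))) here))

  Connected-subdivision : Connected G → Connected H
  Connected-subdivision connected t t′ =
    Reach-++ (proj₂ (to-old t)) (Reach-++ (Reach-bind ι edge-path (connected _ _))
                                          (Reach-reverse (Adj-sym H) (proj₂ (to-old t′))))
    where
    to-old : ∀ t → ∃ λ a → Reach (Adj H) t (ι a)
    to-old t with covers t
    ... | inj₁ (a , refl)         = a , here
    ... | inj₂ (p , q , s , refl) = p , step (Adj-sym H (ιw-adj s)) here

  module Extension (S-aut : ∀ φ {x y} → S x y → S (app G φ x) (app G φ y)) where

    S-aut⁻ : ∀ φ {x y} → S (app G φ x) (app G φ y) → S x y
    S-aut⁻ φ {x} {y} s = subst₂ S (app-invᴬˡ G φ x) (app-invᴬˡ G φ y) (S-aut (invᴬ G φ) s)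

    extendFun : Aut G → Fin (n H) → Fin (n H)
    extendFun φ = elimVertex (ι ∘ app G φ) (λ p q → w (app G φ p) (app G φ q))

    extend-ι : ∀ φ a → extendFun φ (ι a) ≡ ι (app G φ a)
    extend-ι φ = elimVertex-ι _ _

    extend-w : ∀ φ {p q} → S p q → extendFun φ (w p q) ≡ w (app G φ p) (app G φ q)
    extend-w φ = elimVertex-w _ _

    extend-inverse : ∀ φ ψ → (∀ x → app G φ (app G ψ x) ≡ x) →
                     ∀ t → extendFun φ (extendFun ψ t) ≡ t
    extend-inverse φ ψ φψ≗id = vertex-ind _
      (λ a → trans (cong (extendFun φ) (extend-ι ψ a))
                   (trans (extend-ι φ _) (cong ι (φψ≗id a))))
      (λ {p} {q} s → trans (cong (extendFun φ) (extend-w ψ s))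
                       (trans (extend-w φ (S-aut ψ s)) (cong₂ w (φψ≗id p) (φψ≗id q))))

    φ-≡⇔ : ∀ φ {x y} → (app G φ x ≡ app G φ y) ⇔ (x ≡ y)
    φ-≡⇔ φ = mk⇔ (app-injective G φ) (cong (app G φ))

    adj-transport : ∀ {t₁ t₂ t₃ t₄} {A B : Set} → Adj H t₁ t₂ ⇔ A → Adj H t₃ t₄ ⇔ B → A ⇔ B →
                    adj H t₁ t₂ ≡ adj H t₃ t₄
    adj-transport e₁ e₂ A⇔B = Bool.⇔→≡ (mk⇔
      (Equivalence.from e₂ ∘ Equivalence.to A⇔B ∘ Equivalence.to e₁)
      (Equivalence.from e₁ ∘ Equivalence.from A⇔B ∘ Equivalence.to e₂))

    extend-adj : ∀ φ t t′ → adj H (extendFun φ t) (extendFun φ t′) ≡ adj H t t′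
    extend-adj φ =
      vertex-ind _ (λ a → vertex-ind _ (ιι a) (ιw a)) (λ s → vertex-ind _ (wι s) (ww s))
      where
      ιι : ∀ a b → adj H (extendFun φ (ι a)) (extendFun φ (ι b)) ≡ adj H (ι a) (ι b)
      ιι a b = trans (cong₂ (adj H) (extend-ι φ a) (extend-ι φ b))
        (adj-transport (adj-ιι _ _) (adj-ιι a b)
          (mk⇔ (λ (e , ¬s) → trans (sym (app-adj G φ a b)) e , ¬s ∘ S-aut φ)
               (λ (e , ¬s) → trans (app-adj G φ a b) e , ¬s ∘ S-aut⁻ φ)))
      ιw : ∀ a {p q} (s : S p q) →
           adj H (extendFun φ (ι a)) (extendFun φ (w p q)) ≡ adj H (ι a) (w p q)
      ιw a s = trans (cong₂ (adj H) (extend-ι φ a) (extend-w φ s))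
        (adj-transport (adj-ιw _ _ _ (S-aut φ s)) (adj-ιw _ _ _ s) (φ-≡⇔ φ))
      wι : ∀ {p q} (s : S p q) a →
           adj H (extendFun φ (w p q)) (extendFun φ (ι a)) ≡ adj H (w p q) (ι a)
      wι s a = trans (Graph.sym H _ _) (trans (ιw a s) (Graph.sym H _ _))
      ww : ∀ {p q} (s : S p q) {p′ q′} (s′ : S p′ q′) →
           adj H (extendFun φ (w p q)) (extendFun φ (w p′ q′)) ≡ adj H (w p q) (w p′ q′)
      ww s s′ = trans (cong₂ (adj H) (extend-w φ s) (extend-w φ s′))
        (adj-transport (adj-ww _ _ _ _ (S-aut φ s) (S-aut φ s′)) (adj-ww _ _ _ _ s s′)
          (φ-≡⇔ φ ×-⇔ φ-≡⇔ φ))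

    extend : Aut G → Aut H
    extend φ = permutation (extendFun φ) (extendFun (invᴬ G φ))
                 (extend-inverse φ (invᴬ G φ) (app-invᴬʳ G φ))
                 (extend-inverse (invᴬ G φ) φ (app-invᴬˡ G φ)) ,
               extend-adj φ

    extend-injective : ∀ φ χ → app H (extend φ) ≗ app H (extend χ) → app G φ ≗ app G χ
    extend-injective φ χ φ≗χ a =
      ι-inj _ _ (trans (sym (extend-ι φ a)) (trans (φ≗χ (ι a)) (extend-ι χ a)))

    -- Aut G is finite, so the injective map φ ↦ F⁻¹ (extend φ) is onto.
    AutIso⇒extensions : AutIso G H → ∀ ψ → ∃ λ φ → app H ψ ≗ app H (extend φ)
    AutIso⇒extensions (F , F-resp , _ , _ , F-onto) ψ = φ , λ t → begin
      app H ψ t             ≡⟨ proj₂ (F-onto ψ) t ⟨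
      app H (F χ₀) t        ≡⟨ F-resp (θ φ) χ₀ θφ≗χ₀ t ⟨
      app H (F (θ φ)) t     ≡⟨ proj₂ (F-onto (extend φ)) t ⟩
      app H (extend φ) t    ∎
      where
      open ≡-Reasoning
      θ : Aut G → Aut G
      θ φ = proj₁ (F-onto (extend φ))
      θ-injective : ∀ φ χ → app G (θ φ) ≗ app G (θ χ) → app G φ ≗ app G χ
      θ-injective φ χ θφ≗θχ = extend-injective φ χ λ t →
        trans (sym (proj₂ (F-onto (extend φ)) t))
              (trans (F-resp _ _ θφ≗θχ t) (proj₂ (F-onto (extend χ)) t))
      χ₀ : Aut G
      χ₀ = proj₁ (F-onto ψ)
      φ : Aut G
      φ = proj₁ (Aut-injective⇒surjective G θ θ-injective χ₀)
      θφ≗χ₀ : app G (θ φ) ≗ app G χ₀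
      θφ≗χ₀ = proj₂ (Aut-injective⇒surjective G θ θ-injective χ₀)

  Antipodal : (Fin (n H) → ℚ) → Set
  Antipodal f = ∀ {p q} → S p q → f (w p q) ≡ - f (ι q)

  toward-antipodal : ∀ {f} → Antipodal f →
                     ∀ a b → f (toward a b) ≡ σ (does (S? a b)) *ℚ f (ι b)
  toward-antipodal {f} antipodal a b = go (S? a b)
    where
    go : (d : Dec (S a b)) → f (toward′ a b d) ≡ σ (does d) *ℚ f (ι b)
    go (yes s) = trans (antipodal s) (sym (σ-true (f (ι b))))
    go (no _)  = sym (ℚ.*-identityˡ (f (ι b)))

  InKernel⇒Antipodal : ∀ {f} → InKernel H f → Antipodal f
  InKernel⇒Antipodal {f} kernel {p} {q} s =
    inverseʳ-unique (f (ι q)) (f (w p q)) (trans (sym (AdjMul-w f (S-sym s))) (kernel (w q p)))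

  module Kernel {x : Fin (n G) → ℚ} (x-kernel : InKernel G x)
                (sign : Fin (n G) → Bool)
                (signs : ∀ a b → Adj G a b → sign a xor sign b ≡ does (S? a b)) where

    sign-across : ∀ {a b} → Adj G a b → does (S? a b) xor sign b ≡ sign a
    sign-across {a} {b} e rewrite sym (signs a b e) =
      trans (Bool.xor-assoc (sign a) (sign b) (sign b))
        (trans (cong (sign a xor_) (Bool.xor-same (sign b))) (Bool.xor-identityʳ (sign a)))

    sign-back : ∀ {a b} → Adj G a b → sign a xor does (S? a b) ≡ sign b
    sign-back {a} {b} e rewrite sym (signs a b e) =
      trans (sym (Bool.xor-assoc (sign a) (sign a) (sign b)))
            (cong (_xor sign b) (Bool.xor-same (sign a)))

    z : Fin (n H) → ℚ
    z = elimVertex (λ a → σ (sign a) *ℚ x a) (λ p q → - (σ (sign q) *ℚ x q))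

    z-ι : ∀ a → z (ι a) ≡ σ (sign a) *ℚ x a
    z-ι = elimVertex-ι _ _

    z-antipodal : Antipodal z
    z-antipodal s = trans (elimVertex-w _ _ s) (cong -_ (sym (z-ι _)))

    z-kernel : InKernel H z
    z-kernel = vertex-ind _ at-ι at-w
      where
      open ≡-Reasoning
      at-ι : ∀ a → AdjMul H z (ι a) ≡ 0ℚ
      at-ι a = begin
        AdjMul H z (ι a)                      ≡⟨ AdjMul-ι z a ⟩
        AdjMul G (z ∘ toward a) a              ≡⟨ AdjMul-cong G a toward-value ⟩
        AdjMul G (λ b → σ (sign a) *ℚ x b) a   ≡⟨ AdjMul-* G (σ (sign a)) x a ⟩
        σ (sign a) *ℚ AdjMul G x a             ≡⟨ cong (σ (sign a) *ℚ_) (x-kernel a) ⟩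
        σ (sign a) *ℚ 0ℚ                       ≡⟨ ℚ.*-zeroʳ (σ (sign a)) ⟩
        0ℚ                                     ∎
        where
        toward-value : ∀ b → Adj G a b → z (toward a b) ≡ σ (sign a) *ℚ x b
        toward-value b e = begin
          z (toward a b)
            ≡⟨ toward-antipodal {z} z-antipodal a b ⟩
          σ (does (S? a b)) *ℚ z (ι b)
            ≡⟨ cong (σ (does (S? a b)) *ℚ_) (z-ι b) ⟩
          σ (does (S? a b)) *ℚ (σ (sign b) *ℚ x b)
            ≡⟨ σ-*-σ (does (S? a b)) (sign b) (x b) ⟩
          σ (does (S? a b) xor sign b) *ℚ x b
            ≡⟨ cong (λ c → σ c *ℚ x b) (sign-across e) ⟩
          σ (sign a) *ℚ x b
            ∎
      at-w : ∀ {p q} → S p q → AdjMul H z (w p q) ≡ 0ℚ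
      at-w {p} s = trans (AdjMul-w z s)
        (trans (cong (z (ι p) +ℚ_) (z-antipodal (S-sym s))) (ℚ.+-inverseʳ (z (ι p))))

    z-nonzero : (∀ a → x a ≢ 0ℚ) → ∀ t → z t ≢ 0ℚ
    z-nonzero x≢0 = vertex-ind _ ι-nonzero λ s →
      subst (_≢ 0ℚ) (sym (z-antipodal s)) (neg-≢0 (ι-nonzero _))
      where
      ι-nonzero : ∀ a → z (ι a) ≢ 0ℚ
      ι-nonzero a = subst (_≢ 0ℚ) (sym (z-ι a)) (σ*-≢0 (sign a) (x≢0 a))

    module _ {y : Fin (n H) → ℚ} (y-kernel : InKernel H y) where

      restrict : Fin (n G) → ℚ
      restrict a = σ (sign a) *ℚ y (ι a)

      restrict-kernel : InKernel G restrict
      restrict-kernel a = begin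
        AdjMul G restrict a                             ≡⟨ AdjMul-cong G a toward-value ⟩
        AdjMul G (λ b → σ (sign a) *ℚ y (toward a b)) a ≡⟨ AdjMul-* G (σ (sign a)) (y ∘ toward a) a ⟩
        σ (sign a) *ℚ AdjMul G (y ∘ toward a) a         ≡⟨ cong (σ (sign a) *ℚ_) (AdjMul-ι y a) ⟨
        σ (sign a) *ℚ AdjMul H y (ι a)                  ≡⟨ cong (σ (sign a) *ℚ_) (y-kernel (ι a)) ⟩
        σ (sign a) *ℚ 0ℚ                                ≡⟨ ℚ.*-zeroʳ (σ (sign a)) ⟩
        0ℚ                                              ∎
        where
        open ≡-Reasoning
        toward-value : ∀ b → Adj G a b → restrict b ≡ σ (sign a) *ℚ y (toward a b)
        toward-value b e = begin
          σ (sign b) *ℚ y (ι b)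
            ≡⟨ cong (λ c → σ c *ℚ y (ι b)) (sign-back e) ⟨
          σ (sign a xor does (S? a b)) *ℚ y (ι b)
            ≡⟨ σ-*-σ (sign a) (does (S? a b)) (y (ι b)) ⟨
          σ (sign a) *ℚ (σ (does (S? a b)) *ℚ y (ι b))
            ≡⟨ cong (σ (sign a) *ℚ_) (toward-antipodal {y} (InKernel⇒Antipodal y-kernel) a b) ⟨
          σ (sign a) *ℚ y (toward a b)
            ∎

      proportional : ∀ c → (∀ a → restrict a ≡ c *ℚ x a) → ∀ t → y t ≡ c *ℚ z t
      proportional c restrict≡cx = vertex-ind _ at-ι at-w
        where
        open ≡-Reasoning
        at-ι : ∀ a → y (ι a) ≡ c *ℚ z (ι a)
        at-ι a = begin
          y (ι a)                        ≡⟨ σ-involutive (sign a) (y (ι a)) ⟨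
          σ (sign a) *ℚ restrict a        ≡⟨ cong (σ (sign a) *ℚ_) (restrict≡cx a) ⟩
          σ (sign a) *ℚ (c *ℚ x a)        ≡⟨ x∙yz≈y∙xz (σ (sign a)) c (x a) ⟩
          c *ℚ (σ (sign a) *ℚ x a)        ≡⟨ cong (c *ℚ_) (z-ι a) ⟨
          c *ℚ z (ι a)                   ∎
        at-w : ∀ {p q} → S p q → y (w p q) ≡ c *ℚ z (w p q)
        at-w {p} {q} s = begin
          y (w p q)          ≡⟨ InKernel⇒Antipodal y-kernel s ⟩
          - y (ι q)          ≡⟨ cong -_ (at-ι q) ⟩
          - (c *ℚ z (ι q))   ≡⟨ ℚ.neg-distribʳ-* c (z (ι q)) ⟩
          c *ℚ - z (ι q)     ≡⟨ cong (c *ℚ_) (z-antipodal s) ⟨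
          c *ℚ z (w p q)     ∎

  Nut-subdivision : (∀ {p q} → S p q → ¬ Reach (AdjMinus G p q) p q) → Nut G → Nut H
  Nut-subdivision separates (connected , positive , x , x-kernel , x-nonzero , x-unique) =
    Connected-subdivision connected ,
    ℕ.≤-trans positive (injective⇒≤ (ι-inj _ _)) ,
    z , z-kernel , z-nonzero x-nonzero ,
    λ y y-kernel → let (c , restrict≡cx) = x-unique _ (restrict-kernel y-kernel) in
                   c , proportional y-kernel c restrict≡cx
    where
    open Signing G S? S-sym separates using (signing)
    open Kernel x-kernel (proj₁ signing) (proj₂ signing)

does⇔ : ∀ {P : Set} (d : Dec P) → (does d ≡ true) ⇔ P
does⇔ (yes p) = mk⇔ (λ _ → p) (λ _ → refl)
does⇔ (no ¬p) = mk⇔ (λ ()) (λ p → contradiction p ¬p)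

module Construction {G : Graph} {S : Fin (n G) → Fin (n G) → Set}
                    (S? : ∀ x y → Dec (S x y)) (S-sym : ∀ {x y} → S x y → S y x)
                    (S-adj : ∀ {x y} → S x y → Adj G x y) where

  private
    N : ℕ
    N = n G

  pair : Fin (N ℕ.* N) → Fin N × Fin N
  pair = remQuot N

  open Enumeration (enumerate {P = λ c → S (proj₁ (pair c)) (proj₂ (pair c))} (λ c → S? _ _))

  ends : Fin size → Fin N × Fin N
  ends j = pair (element j)

  ends-S : ∀ j → S (proj₁ (ends j)) (proj₂ (ends j))
  ends-S = element-P

  ends-injective : ∀ {i j} → ends i ≡ ends j → i ≡ j
  ends-injective {i} {j} e = trans (sym (index-element i (element-P i))) (index-at element-i≡j)
    where
    element-i≡j : element i ≡ element j
    element-i≡j = begin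
      element i                                 ≡⟨ combine-remQuot {N} N (element i) ⟨
      combine (proj₁ (ends i)) (proj₂ (ends i)) ≡⟨ cong (λ (p , q) → combine p q) e ⟩
      combine (proj₁ (ends j)) (proj₂ (ends j)) ≡⟨ combine-remQuot {N} N (element j) ⟩
      element j                                 ∎
      where open ≡-Reasoning
    index-at : ∀ {c} → c ≡ element j → ∀ {p} → index c p ≡ j
    index-at refl = index-element j _

  slot : ∀ {x y} → S x y → Fin size
  slot {x} {y} s = index (combine x y) (subst (λ (p , q) → S p q) (sym (remQuot-combine x y)) s)

  ends-slot : ∀ {x y} (s : S x y) → ends (slot s) ≡ (x , y)
  ends-slot {x} {y} s = trans (cong pair (element-index _ _)) (remQuot-combine x y)

  ι : Fin N → Fin (N + size)
  ι a = a ↑ˡ size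

  -- The value for a pair outside S is never used.
  w′ : ∀ x y → Dec (S x y) → Fin (N + size)
  w′ x y (yes s) = N ↑ʳ slot s
  w′ x y (no _)  = ι x

  w : Fin N → Fin N → Fin (N + size)
  w x y = w′ x y (S? x y)

  w-slot : ∀ {x y} (s : S x y) → w x y ≡ N ↑ʳ slot s
  w-slot {x} {y} s = go (S? x y)
    where
    go : (d : Dec (S x y)) → w′ x y d ≡ N ↑ʳ slot s
    go (yes s′) = cong (N ↑ʳ_) (ends-injective (trans (ends-slot s′) (sym (ends-slot s))))
    go (no ¬s)  = contradiction s ¬s

  splitAt-ι : ∀ a → splitAt N (ι a) ≡ inj₁ a
  splitAt-ι a = splitAt-↑ˡ N a size

  splitAt-w : ∀ {x y} (s : S x y) → splitAt N (w x y) ≡ inj₂ (slot s)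
  splitAt-w s = trans (cong (splitAt N) (w-slot s)) (splitAt-↑ʳ N size (slot s))

  old? : ∀ a b → Dec (Adj G a b × ¬ S a b)
  old? a b = (adj G a b Bool.≟ true) ×-dec ¬? (S? a b)

  middle? : ∀ i j → Dec (proj₁ (ends i) ≡ proj₂ (ends j) × proj₂ (ends i) ≡ proj₁ (ends j))
  middle? i j = (proj₁ (ends i) ≟ proj₂ (ends j)) ×-dec (proj₂ (ends i) ≟ proj₁ (ends j))

  adjᵛ : Fin N ⊎ Fin size → Fin N ⊎ Fin size → Bool
  adjᵛ (inj₁ a) (inj₁ b) = does (old? a b)
  adjᵛ (inj₁ a) (inj₂ j) = does (a ≟ proj₁ (ends j))
  adjᵛ (inj₂ j) (inj₁ a) = does (a ≟ proj₁ (ends j))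
  adjᵛ (inj₂ i) (inj₂ j) = does (middle? i j)

  adjᵛ-sym : ∀ t t′ → adjᵛ t t′ ≡ adjᵛ t′ t
  adjᵛ-sym (inj₁ a) (inj₁ b) = does-⇔ (mk⇔ flip flip) (old? a b) (old? b a)
    where
    flip : ∀ {a b} → Adj G a b × ¬ S a b → Adj G b a × ¬ S b a
    flip (e , ¬s) = Adj-sym G e , ¬s ∘ S-sym
  adjᵛ-sym (inj₁ a) (inj₂ j) = refl
  adjᵛ-sym (inj₂ j) (inj₁ a) = refl
  adjᵛ-sym (inj₂ i) (inj₂ j) = does-⇔ (mk⇔ flip flip) (middle? i j) (middle? j i)
    where
    flip : ∀ {p q p′ q′ : Fin N} → p ≡ q′ × q ≡ p′ → p′ ≡ q × q′ ≡ p
    flip (e , e′) = sym e′ , sym e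

  adjᵛ-irrefl : ∀ t → adjᵛ t t ≡ false
  adjᵛ-irrefl (inj₁ a) = dec-false (old? a a) (Adj-irrefl G ∘ proj₁)
  adjᵛ-irrefl (inj₂ j) = dec-false (middle? j j) λ (e , _) →
    Adj-irrefl G (subst (λ p → Adj G p (proj₂ (ends j))) e (S-adj (ends-S j)))

  H : Graph
  H = record
    { n      = N + size
    ; adj    = λ t t′ → adjᵛ (splitAt N t) (splitAt N t′)
    ; sym    = λ t t′ → adjᵛ-sym (splitAt N t) (splitAt N t′)
    ; irrefl = λ t → adjᵛ-irrefl (splitAt N t)
    }

  via : ∀ {b c : Bool} {P : Set} → b ≡ c → (c ≡ true) ⇔ P → (b ≡ true) ⇔ P
  via refl c⇔P = c⇔P

  ιw-does⇔ : ∀ {a x y} {e : Fin N × Fin N} → e ≡ (x , y) →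
             (does (a ≟ proj₁ e) ≡ true) ⇔ (a ≡ x)
  ιw-does⇔ {a} {x} refl = does⇔ (a ≟ x)

  ww-does⇔ : ∀ {x y x′ y′} {e e′ : Fin N × Fin N} → e ≡ (x , y) → e′ ≡ (x′ , y′) →
    (does ((proj₁ e ≟ proj₂ e′) ×-dec (proj₂ e ≟ proj₁ e′)) ≡ true) ⇔ (x ≡ y′ × y ≡ x′)
  ww-does⇔ {x} {y} {x′} {y′} refl refl = does⇔ ((x ≟ y′) ×-dec (y ≟ x′))

  w-injective : ∀ {x y x′ y′} → S x y → S x′ y′ → w x y ≡ w x′ y′ → x ≡ x′ × y ≡ y′
  w-injective s s′ e = ×-≡,≡←≡ (begin
    _              ≡⟨ ends-slot s ⟨
    ends (slot s)  ≡⟨ cong ends (↑ʳ-injective N _ _ (trans (sym (w-slot s)) (trans e (w-slot s′)))) ⟩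
    ends (slot s′) ≡⟨ ends-slot s′ ⟩
    _              ∎)
    where open ≡-Reasoning

  covers : ∀ t → (∃ λ z → ι z ≡ t) ⊎ (∃ λ x → ∃ λ y → S x y × w x y ≡ t)
  covers t with splitAt N t in eq
  ... | inj₁ a = inj₁ (a , trans (cong (join N size) (sym eq)) (join-splitAt N size t))
  ... | inj₂ j = inj₂ (_ , _ , ends-S j , trans (w-slot (ends-S j))
        (trans (cong (N ↑ʳ_) (ends-injective (ends-slot (ends-S j))))
               (trans (cong (join N size) (sym eq)) (join-splitAt N size t))))

  bridgeConstruction : BridgeConstruction G S H
  bridgeConstruction = record
    { ι      = ι
    ; w      = w
    ; ι-inj  = λ a b → ↑ˡ-injective size a b
    ; w-inj  = λ x y x′ y′ → w-injective
    ; w≢ι    = λ x y z s e →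
        case trans (sym (splitAt-w s)) (trans (cong (splitAt N) e) (splitAt-ι z)) of λ ()
    ; covers = covers
    ; adj-ιι = λ a b → via (cong₂ adjᵛ (splitAt-ι a) (splitAt-ι b)) (does⇔ (old? a b))
    ; adj-ιw = λ a x y s → via (cong₂ adjᵛ (splitAt-ι a) (splitAt-w s)) (ιw-does⇔ (ends-slot s))
    ; adj-ww = λ x y x′ y′ s s′ →
        via (cong₂ adjᵛ (splitAt-w s) (splitAt-w s′)) (ww-does⇔ (ends-slot s) (ends-slot s′))
    }

classCount-transfer : ∀ {A B : Set} {R : A → A → Set} {R′ : B → B → Set} {k m} →
  HasClassCount A R k → HasClassCount B R′ m → (h : A → B) →
  (∀ a a′ → R a a′ ⇔ R′ (h a) (h a′)) → (∀ b → ∃ λ a → R′ (h a) b) → m ≡ k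
classCount-transfer {A} {k = k} {m} (f , f-onto , f-classes) (g , g-onto , g-classes)
                    h h-classes h-onto =
  sym (cantor-schröder-bernstein α-injective β-injective)
  where
  open Equivalence using (to; from)
  α : Fin k → Fin m
  α j = g (h (proj₁ (f-onto j)))
  α-injective : Injective _≡_ _≡_ α
  α-injective {j} {j′} e = trans (sym (proj₂ (f-onto j))) (trans
    (from (f-classes _ _) (from (h-classes _ _) (to (g-classes _ _) e)))
    (proj₂ (f-onto j′)))
  lift : Fin m → A
  lift i = proj₁ (h-onto (proj₁ (g-onto i)))
  g-lift : ∀ i → g (h (lift i)) ≡ i
  g-lift i = trans (from (g-classes _ _) (proj₂ (h-onto _))) (proj₂ (g-onto i))
  β : Fin m → Fin k
  β i = f (lift i)
  β-injective : Injective _≡_ _≡_ β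
  β-injective {i} {i′} e = trans (sym (g-lift i)) (trans
    (from (g-classes _ _) (to (h-classes _ _) (to (f-classes _ _) e)))
    (g-lift i′))

HasClassCount-⊎ : ∀ {A : Set} {R : A → A → Set} {k} → HasClassCount A R k →
                  ∀ r → HasClassCount (A ⊎ Fin r) (Pointwise R _≡_) (k + r)
HasClassCount-⊎ {A} {R} {k} (f , f-onto , f-classes) r = f′ , f′-onto , f′-classes
  where
  f′ : A ⊎ Fin r → Fin (k + r)
  f′ (inj₁ a) = f a ↑ˡ r
  f′ (inj₂ i) = k ↑ʳ i
  f′-onto : ∀ j → ∃ λ x → f′ x ≡ j
  f′-onto j with splitAt k j in eq
  ... | inj₁ c = inj₁ (proj₁ (f-onto c)) ,
        trans (cong (_↑ˡ r) (proj₂ (f-onto c)))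
              (trans (cong (join k r) (sym eq)) (join-splitAt k r j))
  ... | inj₂ i = inj₂ i , trans (cong (join k r) (sym eq)) (join-splitAt k r j)
  ↑ˡ≢↑ʳ : ∀ c i → c ↑ˡ r ≢ k ↑ʳ i
  ↑ˡ≢↑ʳ c i e =
    case trans (sym (splitAt-↑ˡ k c r)) (trans (cong (splitAt k) e) (splitAt-↑ʳ k r i)) of λ ()
  f′-classes : ∀ x y → (f′ x ≡ f′ y) ⇔ Pointwise R _≡_ x y
  f′-classes (inj₁ a) (inj₁ b) =
    mk⇔ (inj₁ ∘ Equivalence.to (f-classes a b) ∘ ↑ˡ-injective r _ _)
        (λ { (inj₁ ab) → cong (_↑ˡ r) (Equivalence.from (f-classes a b) ab) })
  f′-classes (inj₁ a) (inj₂ i) = mk⇔ (λ e → contradiction e (↑ˡ≢↑ʳ _ _)) λ ()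
  f′-classes (inj₂ i) (inj₁ a) = mk⇔ (λ e → contradiction (sym e) (↑ˡ≢↑ʳ _ _)) λ ()
  f′-classes (inj₂ i) (inj₂ j) = mk⇔ (inj₂ ∘ ↑ʳ-injective k i j) (λ { (inj₂ refl) → refl })

SameEOrbitᵖ : (K : Graph) → Fin (n K) × Fin (n K) → Fin (n K) × Fin (n K) → Set
SameEOrbitᵖ K (a , b) (c , d) = Σ (Aut K) λ ψ → SamePair (app K ψ a) (app K ψ b) c d

SameEOrbitᵖ-resp : ∀ K {a b c d a′ b′ c′ d′} → SamePair a′ b′ a b → SamePair c d c′ d′ →
                   SameEOrbitᵖ K (a , b) (c , d) → SameEOrbitᵖ K (a′ , b′) (c′ , d′)
SameEOrbitᵖ-resp K a′b′≡ab cd≡c′d′ (ψ , sp) =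
  ψ , SamePair-trans (SamePair-map (app K ψ) a′b′≡ab) (SamePair-trans sp cd≡c′d′)

toEdge : ∀ K {t t′} → Adj K t t′ → Σ (Edge K) λ e → SamePair (proj₁ e) (proj₁ (proj₂ e)) t t′
toEdge K {t} {t′} e with <-cmp t t′
... | tri< t<t′ _ _ = (t , t′ , t<t′ , e) , inj₁ (refl , refl)
... | tri≈ _ refl _ = contradiction e (Adj-irrefl K)
... | tri> _ _ t′<t = (t′ , t , t′<t , Adj-sym K e) , inj₂ (refl , refl)

toEdge-orbit⇔ : ∀ K {a b c d} (ab : Adj K a b) (cd : Adj K c d) →
  SameEOrbit K (proj₁ (toEdge K ab)) (proj₁ (toEdge K cd)) ⇔ SameEOrbitᵖ K (a , b) (c , d)
toEdge-orbit⇔ K ab cd with toEdge K ab | toEdge K cd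
... | _ , e≡ab | _ , e′≡cd = mk⇔ (SameEOrbitᵖ-resp K (SamePair-sym e≡ab) e′≡cd)
                                (SameEOrbitᵖ-resp K e≡ab (SamePair-sym e′≡cd))

module OrbitCounting (G : Graph) (u v : Fin (n G)) (uv : Adj G u v) {H : Graph}
                     (B : BridgeConstruction G (InEdgeOrbit G u v) H) where

  open EdgeOrbit G u v
  open BridgeConstruction B
  open Subdivision S? S-sym (S-adj uv) B
  open Extension S-aut

  module _ (extensions : ∀ ψ → ∃ λ φ → app H ψ ≗ app H (extend φ)) (r : ℕ)
           (reps : OrbitRepresentatives r) where

    open OrbitRepresentatives reps

    image-ι : ∀ ψ a {p q} → S p q → app H ψ (ι a) ≢ w p q
    image-ι ψ a s e = let (φ , ψ≗φ) = extensions ψ in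
      w≢ι _ _ _ s (trans (sym e) (trans (ψ≗φ (ι a)) (extend-ι φ a)))

    image-w : ∀ ψ a {p q} → S p q → app H ψ (w p q) ≢ ι a
    image-w ψ a s e = let (φ , ψ≗φ) = extensions ψ in
      w≢ι _ _ _ (S-aut φ s) (trans (sym (extend-w φ s)) (trans (sym (ψ≗φ _)) e))

    w-orbit⇔ : ∀ {p q p′ q′} → S p q → S p′ q′ →
               SameVOrbit H (w p q) (w p′ q′) ⇔ PairOrbit (p , q) (p′ , q′)
    w-orbit⇔ s s′ = mk⇔
      (λ (ψ , e) → let (φ , ψ≗φ) = extensions ψ in
        φ , w-inj _ _ _ _ (S-aut φ s) s′ (trans (sym (extend-w φ s)) (trans (sym (ψ≗φ _)) e)))
      (λ (φ , φp≡p′ , φq≡q′) → extend φ , trans (extend-w φ s) (cong₂ w φp≡p′ φq≡q′))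

    ι-orbit⇔ : ∀ {a b} → SameVOrbit H (ι a) (ι b) ⇔ SameVOrbit G a b
    ι-orbit⇔ = mk⇔
      (λ (ψ , e) → let (φ , ψ≗φ) = extensions ψ in
        φ , ι-inj _ _ (trans (sym (extend-ι φ _)) (trans (sym (ψ≗φ _)) e)))
      (λ (φ , e) → extend φ , trans (extend-ι φ _) (cong ι e))

    vertexCount : ∀ a b → VOrbitCount G a → VOrbitCount H b → b ≡ a + r
    vertexCount a b countG countH =
      classCount-transfer (HasClassCount-⊎ countG r) countH vertex same-orbit onto
      where
      vertex : Fin (n G) ⊎ Fin r → Fin (n H)
      vertex (inj₁ x) = ι x
      vertex (inj₂ i) = w (proj₁ (rep i)) (proj₂ (rep i))
      same-orbit : ∀ α β → Pointwise (SameVOrbit G) _≡_ α β ⇔ SameVOrbit H (vertex α) (vertex β)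
      same-orbit (inj₁ x) (inj₁ y) = mk⇔ (λ { (inj₁ o) → Equivalence.from ι-orbit⇔ o })
                                         (inj₁ ∘ Equivalence.to ι-orbit⇔)
      same-orbit (inj₁ x) (inj₂ j) = mk⇔ (λ ()) λ (ψ , e) → contradiction e (image-ι ψ x (rep-S j))
      same-orbit (inj₂ i) (inj₁ y) = mk⇔ (λ ()) λ (ψ , e) → contradiction e (image-w ψ y (rep-S i))
      same-orbit (inj₂ i) (inj₂ j) = mk⇔ (λ { (inj₂ refl) → idᴬ H , refl })
        (inj₂ ∘ rep-distinct i j ∘ Equivalence.to (w-orbit⇔ (rep-S i) (rep-S j)))
      onto : ∀ t → ∃ λ α → SameVOrbit H (vertex α) t
      onto = vertex-ind _ (λ a → inj₁ a , idᴬ H , refl) λ s →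
        let (i , o) = rep-covers s in inj₂ i , Equivalence.from (w-orbit⇔ (rep-S i) s) o

    isNew : Fin (n H) → ℕ
    isNew = elimVertex (λ _ → 0) (λ _ _ → 1)

    isNew-ι : ∀ a → isNew (ι a) ≡ 0
    isNew-ι = elimVertex-ι _ _

    isNew-w : ∀ {p q} → S p q → isNew (w p q) ≡ 1
    isNew-w = elimVertex-w _ _

    isNew-aut : ∀ ψ t → isNew (app H ψ t) ≡ isNew t
    isNew-aut ψ t = let (φ , ψ≗φ) = extensions ψ in trans (cong isNew (ψ≗φ t)) (vertex-ind
      (λ t → isNew (extendFun φ t) ≡ isNew t)
      (λ a → trans (cong isNew (extend-ι φ a)) (trans (isNew-ι _) (sym (isNew-ι a))))
      (λ s → trans (cong isNew (extend-w φ s)) (trans (isNew-w (S-aut φ s)) (sym (isNew-w s))))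
      t)

    SamePair-w : ∀ {x y p q} → SamePair x y p q → SamePair (w x y) (w y x) (w p q) (w q p)
    SamePair-w (inj₁ (refl , refl)) = inj₁ (refl , refl)
    SamePair-w (inj₂ (refl , refl)) = inj₂ (refl , refl)

    S-orbit : ∀ {x y x′ y′} → S x y → S x′ y′ → SameEOrbitᵖ G (x , y) (x′ , y′)
    S-orbit (φ , φuv≡xy) (φ′ , φ′uv≡x′y′) = compᴬ G φ′ (invᴬ G φ) ,
      SamePair-trans (SamePair-map (app G (compᴬ G φ′ (invᴬ G φ))) (SamePair-sym φuv≡xy))
        (subst₂ (λ a b → SamePair (app G φ′ a) (app G φ′ b) _ _)
                (sym (app-invᴬˡ G φ u)) (sym (app-invᴬˡ G φ v)) φ′uv≡x′y′)

    ι-edge-orbit⇔ : ∀ {x y x′ y′} →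
                    SameEOrbitᵖ H (ι x , ι y) (ι x′ , ι y′) ⇔ SameEOrbitᵖ G (x , y) (x′ , y′)
    ι-edge-orbit⇔ {x} {y} {x′} {y′} = mk⇔
      (λ (ψ , sp) → let (φ , ψ≗φ) = extensions ψ in φ , unι (subst₂ (λ a b → SamePair a b _ _)
        (trans (ψ≗φ (ι x)) (extend-ι φ x)) (trans (ψ≗φ (ι y)) (extend-ι φ y)) sp))
      (λ (φ , sp) → extend φ , subst₂ (λ a b → SamePair a b _ _)
        (sym (extend-ι φ x)) (sym (extend-ι φ y)) (SamePair-map ι sp))
      where
      unι : ∀ {a b} → SamePair (ι a) (ι b) (ι x′) (ι y′) → SamePair a b x′ y′
      unι (inj₁ (e , e′)) = inj₁ (ι-inj _ _ e , ι-inj _ _ e′)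
      unι (inj₂ (e , e′)) = inj₂ (ι-inj _ _ e , ι-inj _ _ e′)

    w-edge-orbit : ∀ {x y x′ y′} → S x y → SameEOrbitᵖ G (x , y) (x′ , y′) →
                   SameEOrbitᵖ H (w x y , w y x) (w x′ y′ , w y′ x′)
    w-edge-orbit {x} {y} s (φ , sp) = extend φ ,
      subst₂ (λ a b → SamePair a b _ _) (sym (extend-w φ s)) (sym (extend-w φ (S-sym s)))
             (SamePair-w sp)

    spoke-orbit⇔ : ∀ {p q p′ q′} → S p q → S p′ q′ →
                   SameEOrbitᵖ H (ι p , w p q) (ι p′ , w p′ q′) ⇔ PairOrbit (p , q) (p′ , q′)
    spoke-orbit⇔ {p} s s′ = mk⇔
      (λ { (ψ , inj₁ (_ , e)) → Equivalence.to (w-orbit⇔ s s′) (ψ , e)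
         ; (ψ , inj₂ (e , _)) → contradiction e (image-ι ψ p s′) })
      (λ (φ , φp≡p′ , φq≡q′) → extend φ ,
        inj₁ (trans (extend-ι φ p) (cong ι φp≡p′) , trans (extend-w φ s) (cong₂ w φp≡p′ φq≡q′)))

    oldEnds : ∀ x y → Dec (S x y) → Fin (n H) × Fin (n H)
    oldEnds x y (yes _) = w x y , w y x
    oldEnds x y (no _)  = ι x , ι y

    -- Automorphisms of H preserve the number of new endpoints of an edge.
    kind : Fin (n H) × Fin (n H) → ℕ
    kind (a , b) = isNew a + isNew b

    kind-invariant : ∀ {e e′} → SameEOrbitᵖ H e e′ → kind e ≡ kind e′
    kind-invariant {a , b} {_ , _} (ψ , inj₁ (refl , refl)) =
      sym (cong₂ _+_ (isNew-aut ψ a) (isNew-aut ψ b))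
    kind-invariant {a , b} {_ , _} (ψ , inj₂ (refl , refl)) =
      trans (ℕ.+-comm (isNew a) (isNew b)) (sym (cong₂ _+_ (isNew-aut ψ b) (isNew-aut ψ a)))

    kind-ιι : ∀ x y → kind (ι x , ι y) ≡ 0
    kind-ιι x y = cong₂ _+_ (isNew-ι x) (isNew-ι y)

    kind-spoke : ∀ {p q} → S p q → kind (ι p , w p q) ≡ 1
    kind-spoke {p} s = cong₂ _+_ (isNew-ι p) (isNew-w s)

    kind-middle : ∀ {x y} → S x y → kind (w x y , w y x) ≡ 2
    kind-middle s = cong₂ _+_ (isNew-w s) (isNew-w (S-sym s))

    kind-old : ∀ {x y} d → kind (oldEnds x y d) ≢ 1
    kind-old     (yes s) e = case trans (sym (kind-middle s)) e of λ ()
    kind-old {x} {y} (no _) e = case trans (sym (kind-ιι x y)) e of λ ()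

    old-orbit⇔ : ∀ {x y x′ y′} d d′ →
      SameEOrbitᵖ G (x , y) (x′ , y′) ⇔ SameEOrbitᵖ H (oldEnds x y d) (oldEnds x′ y′ d′)
    old-orbit⇔ (yes s) (yes s′) = mk⇔ (w-edge-orbit s) (λ _ → S-orbit s s′)
    old-orbit⇔ (no _)  (no _)   = ⇔-sym ι-edge-orbit⇔
    old-orbit⇔ {x′ = x′} {y′} (yes s) (no ¬s′) = mk⇔
      (λ (φ , sp) → contradiction (S-resp (SamePair-sym sp) (S-aut φ s)) ¬s′)
      (λ o → case trans (sym (kind-middle s)) (trans (kind-invariant o) (kind-ιι x′ y′)) of λ ())
    old-orbit⇔ {x} {y} (no ¬s) (yes s′) = mk⇔
      (λ (φ , sp) → contradiction (S-aut⁻ φ (S-resp sp s′)) ¬s)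
      (λ o → case trans (sym (kind-ιι x y)) (trans (kind-invariant o) (kind-middle s′)) of λ ())

    edgeCount : ∀ a b → EOrbitCount G a → EOrbitCount H b → b ≡ a + r
    edgeCount a b countG countH =
      classCount-transfer (HasClassCount-⊎ countG r) countH edge same-orbit onto
      where
      ends : Edge G ⊎ Fin r → Fin (n H) × Fin (n H)
      ends (inj₁ (x , y , _ , _)) = oldEnds x y (S? x y)
      ends (inj₂ i)               = ι (proj₁ (rep i)) , w (proj₁ (rep i)) (proj₂ (rep i))

      ends-adj : ∀ α → Adj H (proj₁ (ends α)) (proj₂ (ends α))
      ends-adj (inj₁ (x , y , _ , xy)) = old-adj (S? x y)
        where
        old-adj : ∀ d → Adj H (proj₁ (oldEnds x y d)) (proj₂ (oldEnds x y d))
        old-adj (yes s) = ww-adj s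
        old-adj (no ¬s) = Equivalence.from (adj-ιι x y) (xy , ¬s)
      ends-adj (inj₂ i) = ιw-adj (rep-S i)

      edge : Edge G ⊎ Fin r → Edge H
      edge α = proj₁ (toEdge H (ends-adj α))

      ends-orbit⇔ : ∀ α β → Pointwise (SameEOrbit G) _≡_ α β ⇔
        SameEOrbitᵖ H (ends α) (ends β)
      ends-orbit⇔ (inj₁ (x , y , _)) (inj₁ (x′ , y′ , _)) =
        old-orbit⇔ (S? x y) (S? x′ y′) ⇔-∘ mk⇔ (λ { (inj₁ o) → o }) inj₁
      ends-orbit⇔ (inj₁ (x , y , _)) (inj₂ j) = mk⇔ (λ ()) λ o →
        contradiction (trans (kind-invariant o) (kind-spoke (rep-S j))) (kind-old (S? x y))
      ends-orbit⇔ (inj₂ i) (inj₁ (x , y , _)) = mk⇔ (λ ()) λ o →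
        contradiction (trans (sym (kind-invariant o)) (kind-spoke (rep-S i))) (kind-old (S? x y))
      ends-orbit⇔ (inj₂ i) (inj₂ j) = ⇔-sym (spoke-orbit⇔ (rep-S i) (rep-S j)) ⇔-∘
        mk⇔ (λ { (inj₂ refl) → idᴬ G , refl , refl }) (inj₂ ∘ rep-distinct i j)

      same-orbit : ∀ α β → Pointwise (SameEOrbit G) _≡_ α β ⇔ SameEOrbit H (edge α) (edge β)
      same-orbit α β = ⇔-sym (toEdge-orbit⇔ H (ends-adj α) (ends-adj β)) ⇔-∘ ends-orbit⇔ α β

      Covered : Fin (n H) → Fin (n H) → Set
      Covered t t′ = ∃ λ α → SameEOrbitᵖ H (ends α) (t , t′)

      ιι : ∀ x y → Adj H (ι x) (ι y) → Covered (ι x) (ι y)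
      ιι x y a with Equivalence.to (adj-ιι x y) a
      ... | xy , ¬s with toEdge G xy
      ...   | e , x₀y₀≡xy = inj₁ e , old (S? _ _)
        where
        old : ∀ d → SameEOrbitᵖ H (oldEnds _ _ d) (ι x , ι y)
        old (yes s₀) = contradiction (S-resp (SamePair-sym x₀y₀≡xy) s₀) ¬s
        old (no _)   = idᴬ H , SamePair-map ι x₀y₀≡xy

      ιw : ∀ x {p q} (s : S p q) → Adj H (ι x) (w p q) → Covered (ι x) (w p q)
      ιw x s a with Equivalence.to (adj-ιw _ _ _ s) a
      ... | refl = let (i , o) = rep-covers s in
                   inj₂ i , Equivalence.from (spoke-orbit⇔ (rep-S i) s) o

      wι : ∀ {p q} (s : S p q) x → Adj H (w p q) (ι x) → Covered (w p q) (ι x)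
      wι s x a = let (α , o) = ιw x s (Adj-sym H a) in
        α , SameEOrbitᵖ-resp H (inj₁ (refl , refl)) (inj₂ (refl , refl)) o

      ww : ∀ {p q} (s : S p q) {p′ q′} (s′ : S p′ q′) →
           Adj H (w p q) (w p′ q′) → Covered (w p q) (w p′ q′)
      ww {p} {q} s s′ a with Equivalence.to (adj-ww _ _ _ _ s s′) a
      ... | refl , refl with toEdge G (S-adj uv s)
      ...   | e , x₀y₀≡pq = inj₁ e , middle (S? _ _)
        where
        middle : ∀ d → SameEOrbitᵖ H (oldEnds _ _ d) (w p q , w q p)
        middle (yes _)  = idᴬ H , SamePair-w x₀y₀≡pq
        middle (no ¬s₀) = contradiction (S-resp x₀y₀≡pq s) ¬s₀

      onto : ∀ e → ∃ λ α → SameEOrbit H (edge α) e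
      onto (t , t′ , _ , a) =
        let (α , o) = vertex-ind (λ t → ∀ t′ → Adj H t t′ → Covered t t′)
                        (λ x → vertex-ind _ (ιι x) (ιw x)) (λ s → vertex-ind _ (wι s) (ww s)) t t′ a in
        α , SameEOrbitᵖ-resp H (proj₂ (toEdge H (ends-adj α))) (inj₁ (refl , refl)) o

    orbitCounts : (∀ a b → VOrbitCount G a → VOrbitCount H b → b ≡ a + r) ×
                  (∀ a b → EOrbitCount G a → EOrbitCount H b → b ≡ a + r)
    orbitCounts = vertexCount , edgeCount

proposition25 : (G : Graph) → Nut G → (u v : Fin (n G)) → IsBridge G u v →
    (Σ Graph λ H → BridgeConstruction G (InEdgeOrbit G u v) H) ×
    ((H : Graph) → (B : BridgeConstruction G (InEdgeOrbit G u v) H) →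
      Nut H ×
      ((φ : Aut G) → Σ (Aut H) λ ψ →
        (∀ z → app H ψ (BridgeConstruction.ι B z) ≡ BridgeConstruction.ι B (app G φ z)) ×
        (∀ x y → InEdgeOrbit G u v x y →
          app H ψ (BridgeConstruction.w B x y) ≡ BridgeConstruction.w B (app G φ x) (app G φ y))) ×
      (AutIso G H →
        ((Σ (Aut G) λ φ → app G φ u ≡ v × app G φ v ≡ u) →
          (∀ a b → VOrbitCount G a → VOrbitCount H b → b ≡ a + 1) ×
          (∀ a b → EOrbitCount G a → EOrbitCount H b → b ≡ a + 1)) ×
        (¬ (Σ (Aut G) λ φ → app G φ u ≡ v × app G φ v ≡ u) →
          (∀ a b → VOrbitCount G a → VOrbitCount H b → b ≡ a + 2) ×
          (∀ a b → EOrbitCount G a → EOrbitCount H b → b ≡ a + 2))))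
proposition25 G nut@(connected , _) u v bridge@(uv , _) =
  (Construction.H S? S-sym (S-adj uv) , Construction.bridgeConstruction S? S-sym (S-adj uv)) ,
  λ H B → let open Subdivision S? S-sym (S-adj uv) B
              open Extension S-aut
              open OrbitCounting G u v uv B
          in Nut-subdivision (S-separates connected bridge) nut ,
             (λ φ → extend φ , extend-ι φ , λ _ _ → extend-w φ) ,
             λ iso → (orbitCounts (AutIso⇒extensions iso) 1 ∘ representatives-swap) ,
                     (orbitCounts (AutIso⇒extensions iso) 2 ∘ representatives-no-swap)
  where open EdgeOrbit G u v
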